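{- Consider the following algorithm for online bipartite matching. Let $L'$ be the set of the first $\lfloor n/e\rfloor$ arriving vertices of $L$ and $M\leftarrow\emptyset$. For each subsequently arriving vertex $\ell$: set $L'\leftarrow L'\cup\{\ell\}$, compute the greedy matching $M^{(\ell)}$ on the induced subgraph $G[L'\cup R]$, let $e^{(\ell)}=(\ell,r)$ be the edge assigned to $\ell$ in $M^{(\ell)}$ (if any), and if $M\cup\{e^{(\ell)}\}$ is a matching, add $e^{(\ell)}$ to $M$. Index the vertices of $L$ by their arrival position $1,\dots,n$, and let the random variable $A_\ell$ denote the weight of the edge assigned to the $\ell$-th arriving vertex in the final matching $M$ ($0$ if none). Let $w(M^*)$ be the weight of a maximum-weight matching of $G$. Then for every $\ell\in\{\lceil n/e\rceil,\dots,n\}$, $$\mathbb{E}[A_\ell]\ge \frac{\lfloor n/e\rfloor}{\ell-1}\cdot\frac{w(M^*)}{2n},$$ where the expectation is over the uniformly random arrival order.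
   Context: Online bipartite matching: $G$ is a bipartite graph with vertex sides $R$ (known in advance) and $L$ with $|L|=n$ known in advance; the vertices of $L$ arrive one by one in uniformly random order, each revealing its incident edges; every edge $e$ has weight $w(e)\ge 0$. In the ordinal model the algorithm only sees a strict total order of all edges revealed so far, consistent with their weights (ties broken arbitrarily). On arrival of a vertex of $L$ the algorithm must irrevocably decide to which (if any) vertex of $R$ to match it. The greedy matching on a graph: consider edges in decreasing order of the given total order and add an edge whenever both its endpoints are still unmatched.
   Formalization: The edge weights are nonnegative rationals. -}

module Defs where

open import Data.Bool using (Bool; true; false; not; _∧_; if_then_else_)
open import Data.Nat as ℕ using (ℕ; zero; suc; _⊔_; _!)
open import Data.Nat.Properties using (_!≢0)
open import Data.Fin as Fin using (Fin; toℕ)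
open import Data.Maybe using (Maybe; just; nothing)
open import Data.Bool.ListAction using (any; all)
open import Data.List using (List; []; _∷_; foldl; foldr; map; downFrom; concatMap; filter; length; allFin; upTo)
open import Data.Vec as Vec using (Vec; lookup)
open import Data.Integer using (+_)
open import Data.Rational using (ℚ; _/_; 0ℚ; _+_; _*_; _≤_; _<_)
open import Data.Product using (_×_; ∃; _,_)
open import Relation.Nullary using (does)
open import Relation.Binary.PropositionalEquality using (_≡_)

ℕtoℚ : ℕ → ℚ
ℕtoℚ m = (+ m) / 1

-- Euler's number e via partial sums S_m = Σ_{j=0}^{m} 1/j!,
-- and the floor of n/e:  k = ⌊n/e⌋  iff  k·e ≤ n < (k+1)·e.
-- Since S_m increases strictly to e:  k·e ≤ n  iff  ∀ m, k·S_m ≤ n,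
-- and n < (k+1)·e  iff  ∃ m, n < (k+1)·S_m.

invFact : ℕ → ℚ
invFact j = _/_ (+ 1) (j !) {{j !≢0}}

eApprox : ℕ → ℚ
eApprox zero    = invFact 0
eApprox (suc m) = eApprox m + invFact (suc m)

IsFloorNDivE : ℕ → ℕ → Set
IsFloorNDivE n k =
  (∀ m → ℕtoℚ k * eApprox m ≤ ℕtoℚ n) ×
  (∃ λ m → ℕtoℚ n < ℕtoℚ (suc k) * eApprox m)

-- The strict total order on edges is given by an injective rank
-- `rank` (larger rank = earlier in the decreasing order), consistent
-- with the weights.

Adj : ℕ → ℕ → Set
Adj n r = Fin n → Fin r → Bool

Weights : ℕ → ℕ → Set
Weights n r = Fin n → Fin r → ℚ

Rank : ℕ → ℕ → Set
Rank n r = Fin n → Fin r → ℕ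

NonNegWeights : ∀ {n r} → Adj n r → Weights n r → Set
NonNegWeights {n} {r} adj w = ∀ (i : Fin n) (j : Fin r) → adj i j ≡ true → 0ℚ ≤ w i j

IsEdgeOrder : ∀ {n r} → Adj n r → Weights n r → Rank n r → Set
IsEdgeOrder {n} {r} adj w rank =
  (∀ (i i′ : Fin n) (j j′ : Fin r) → adj i j ≡ true → adj i′ j′ ≡ true →
     rank i j ≡ rank i′ j′ → (i ≡ i′) × (j ≡ j′)) ×
  (∀ (i i′ : Fin n) (j j′ : Fin r) → adj i j ≡ true → adj i′ j′ ≡ true →
     w i j < w i′ j′ → rank i j ℕ.< rank i′ j′)

Matching : ℕ → ℕ → Set
Matching n r = Fin n → Maybe (Fin r)

emptyM : ∀ {n r} → Matching n r
emptyM _ = nothing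

IsMatching : ∀ {n r} → Adj n r → Matching n r → Set
IsMatching {n} {r} adj M =
  (∀ (i : Fin n) (j : Fin r) → M i ≡ just j → adj i j ≡ true) ×
  (∀ (i i′ : Fin n) (j : Fin r) → M i ≡ just j → M i′ ≡ just j → i ≡ i′)

sumℚ : List ℚ → ℚ
sumℚ = foldr _+_ 0ℚ

weightAt : ∀ {n r} → Weights n r → Matching n r → Fin n → ℚ
weightAt w M i with M i
... | nothing = 0ℚ
... | just j  = w i j

weight : ∀ {n r} → Weights n r → Matching n r → ℚ
weight {n} w M = sumℚ (map (weightAt w M) (allFin n))

IsMaxWeightMatching : ∀ {n r} → Adj n r → Weights n r → Matching n r → Set
IsMaxWeightMatching adj w M =
  IsMatching adj M × (∀ M′ → IsMatching adj M′ → weight w M′ ≤ weight w M)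

_==ᶠ_ : ∀ {m} → Fin m → Fin m → Bool
a ==ᶠ b = does (a Fin.≟ b)

isMatchedTo : ∀ {r} → Maybe (Fin r) → Fin r → Bool
isMatchedTo nothing  j = false
isMatchedTo (just j′) j = j′ ==ᶠ j

isFree : ∀ {r} → Maybe (Fin r) → Bool
isFree nothing  = true
isFree (just _) = false

rightFree : ∀ {n r} → Matching n r → Fin r → Bool
rightFree {n} M j = not (any (λ i → isMatchedTo (M i) j) (allFin n))

update : ∀ {n r} → Matching n r → Fin n → Fin r → Matching n r
update M i j i′ = if i′ ==ᶠ i then just j else M i′

-- Greedy matching on G[S ∪ R] (S : subset of L as a Boolean predicate):
-- edges are considered in decreasing order of rank; an edge is added
-- whenever both endpoints are still unmatched.

allPairs : (n r : ℕ) → List (Fin n × Fin r)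
allPairs n r = concatMap (λ i → map (λ j → (i , j)) (allFin r)) (allFin n)

maxRank : ∀ {n r} → Rank n r → ℕ
maxRank {n} {r} rank = foldr (λ { (i , j) acc → rank i j ⊔ acc }) 0 (allPairs n r)

greedyStep : ∀ {n r} → Adj n r → Rank n r → (Fin n → Bool) →
             Matching n r → ℕ → Matching n r
greedyStep {n} {r} adj rank S M k = foldl consider M (allPairs n r)
  where
  consider : Matching n r → Fin n × Fin r → Matching n r
  consider M′ (i , j) =
    if S i ∧ adj i j ∧ does (rank i j ℕ.≟ k) ∧ isFree (M′ i) ∧ rightFree M′ j
    then update M′ i j else M′

greedy : ∀ {n r} → Adj n r → Rank n r → (Fin n → Bool) → Matching n r
greedy adj rank S = foldl (greedyStep adj rank S) emptyM (downFrom (suc (maxRank rank)))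

-- Arrival orders: σ : Vec (Fin n) n with σ[p] = vertex arriving at
-- (0-indexed) position p; the uniform distribution is over all
-- injective such vectors (= all permutations).

allVecs : (n : ℕ) → (m : ℕ) → List (Vec (Fin n) m)
allVecs n zero    = Vec.[] ∷ []
allVecs n (suc m) = concatMap (λ x → map (x Vec.∷_) (allVecs n m)) (allFin n)

isInjective : ∀ {n m} → Vec (Fin n) m → Bool
isInjective {n} {m} σ =
  all (λ p → all (λ q → not (lookup σ p ==ᶠ lookup σ q) ∨′ (p ==ᶠ q)) (allFin m)) (allFin m)
  where
  _∨′_ : Bool → Bool → Bool
  true  ∨′ _ = true
  false ∨′ b = b

permutations : (n : ℕ) → List (Vec (Fin n) n)
permutations n = filter (λ σ → isInjective σ Data.Bool.≟ true) (allVecs n n)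
  where import Data.Bool

-- uniform expectation over a finite list (0 for the empty list)
mean : ∀ {A : Set} → (A → ℚ) → List A → ℚ
mean f []         = 0ℚ
mean f (x ∷ xs)   = sumℚ (map f (x ∷ xs)) * ((+ 1) / suc (length xs))

-- L' after the arrival at (0-indexed) position p: {σ[0],…,σ[p]}
arrivedUpTo : ∀ {n} → Vec (Fin n) n → Fin n → (Fin n → Bool)
arrivedUpTo {n} σ p i = any (λ q → does (toℕ q ℕ.≤? toℕ p) ∧ (lookup σ q ==ᶠ i)) (allFin n)

algStep : ∀ {n r} → Adj n r → Rank n r → ℕ → Vec (Fin n) n →
          Matching n r → Fin n → Matching n r
algStep adj rank k σ M p with does (k ℕ.≤? toℕ p)
... | false = M
... | true with greedy adj rank (arrivedUpTo σ p) (lookup σ p)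
...   | nothing = M
...   | just j  = if isFree (M (lookup σ p)) ∧ rightFree M j
                  then update M (lookup σ p) j else M

runAlg : ∀ {n r} → Adj n r → Rank n r → ℕ → Vec (Fin n) n → Matching n r
runAlg {n} adj rank k σ = foldl (algStep adj rank k σ) emptyM (allFin n)

-- A_ℓ for ℓ = toℕ p + 1: weight assigned to the ℓ-th arriving vertex
A : ∀ {n r} → Adj n r → Weights n r → Rank n r → ℕ →
    Fin n → Vec (Fin n) n → ℚ
A adj w rank k p σ = weightAt w (runAlg adj rank k σ) (lookup σ p)

ExpectedA : ∀ {n r} → Adj n r → Weights n r → Rank n r → ℕ → Fin n → ℚ
ExpectedA {n} adj w rank k p = mean (A adj w rank k p) (permutations n)

-- Fix the arrival position t = ℓ - 1 (positions are 0-indexed) and call the edge that greedy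
-- assigns to the t-th arrival inside G[first t + 1 arrivals ∪ R] its proposal, of weight X.
-- Greedy is a 1/2-approximation on every induced subgraph, and the first t + 1 arrivals form
-- a uniformly random set of t + 1 vertices, so E[X] ≥ w(M*)/(2n).  The algorithm accepts the
-- proposal whenever no proposal at a position in [k, t) took the same right vertex; let Y_m
-- be X on the event that no proposal at a position in [m, t) does.  Given the set of the
-- first m + 1 arrivals and the order of the later ones, the arrival at position m is uniform
-- among m + 1 vertices, and greedy matches at most one of them to that right vertex; hence
-- m E[Y_{m+1}] ≤ (m + 1) E[Y_m], and telescoping from k to t gives
-- E[A_ℓ] ≥ E[Y_k] ≥ (k/t) E[X] ≥ k w(M*)/(2nt).
-- Expectations are sums over all arrival orders, and each symmetry argument is a bijection
-- of arrival orders that moves one arrival to a later position.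

module Submission where

open import Algebra.Bundles using (CommutativeRing)
open import Data.Bool as Bool using (Bool; true; false; not; _∧_; _∨_; if_then_else_; T)
open import Data.Bool.ListAction using (any; all)
import Data.Bool.Properties as Boolₚ
open import Data.Fin as Fin using (Fin; zero; suc; toℕ; fromℕ<)
import Data.Fin.Properties as Finₚ
import Data.Integer as ℤ
import Data.Integer.Properties as ℤₚ
open import Data.List using (List; []; _∷_; map; foldl; foldr; allFin; downFrom; filter; concatMap; _++_; length; tabulate)
import Data.List.Properties as Listₚ
open import Data.List.Membership.Propositional using (_∈_)
open import Data.List.Membership.Propositional.Properties using (∈-allFin; ∈-map⁺; ∈-concatMap⁺; ∈-filter⁺)
open import Data.List.Relation.Unary.All as All using (All; []; _∷_)
open import Data.List.Relation.Unary.Any as Any using (here; there)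
open import Data.Maybe using (Maybe; just; nothing)
open import Data.Nat as ℕ using (ℕ; _∸_)
import Data.Nat.Coprimality as Coprimality
import Data.Nat.Properties as ℕₚ
open import Data.Product using (_×_; _,_; ∃; ∃₂; proj₁; proj₂)
open import Data.Sum using (_⊎_; inj₁; inj₂)
open import Data.Unit using (⊤)
open import Data.Vec as Vec using (Vec; lookup; _∷_; [])
import Data.Vec.Properties as Vecₚ
open import Function using (_∘_; id; case_of_)
open import Function.Definitions using (Injective)
open import Relation.Nullary using (does; yes; no; contradiction)
open import Relation.Nullary.Decidable using (dec-true; dec-false)
open import Relation.Unary using (Decidable)
open import Relation.Binary.PropositionalEquality
open import Defs

module BooleanFacts where
  ≡-from-⇔true : ∀ {a b} → (a ≡ true → b ≡ true) → (b ≡ true → a ≡ true) → a ≡ b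
  ≡-from-⇔true {true}  {true}  _ _ = refl
  ≡-from-⇔true {true}  {false} a⇒b _ = sym (a⇒b refl)
  ≡-from-⇔true {false} {true}  _ b⇒a = b⇒a refl
  ≡-from-⇔true {false} {false} _ _ = refl

  ∧-true : ∀ {a b} → a ∧ b ≡ true → a ≡ true × b ≡ true
  ∧-true {true} b≡true = refl , b≡true

  module _ {A : Set} (p : A → Bool) where
    any-true : ∀ xs → any p xs ≡ true → ∃ λ x → x ∈ xs × p x ≡ true
    any-true (x ∷ xs) any≡true with p x in px
    ... | true  = x , here refl , px
    ... | false = let y , y∈xs , py = any-true xs any≡true in y , there y∈xs , py

    any-intro : ∀ {x} xs → x ∈ xs → p x ≡ true → any p xs ≡ true
    any-intro (y ∷ xs) (here refl) px rewrite px = refl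
    any-intro (y ∷ xs) (there x∈xs) px with p y
    ... | true  = refl
    ... | false = any-intro xs x∈xs px

    all-true : ∀ xs → all p xs ≡ true → ∀ {x} → x ∈ xs → p x ≡ true
    all-true (y ∷ xs) all≡true (here refl)  = proj₁ (∧-true all≡true)
    all-true (y ∷ xs) all≡true (there x∈xs) = all-true xs (proj₂ (∧-true {p y} all≡true)) x∈xs

    all-false : ∀ xs → all p xs ≡ false → ∃ λ x → x ∈ xs × p x ≡ false
    all-false (x ∷ xs) all≡false with p x in px
    ... | false = x , here refl , px
    ... | true  = let y , y∈xs , py = all-false xs all≡false in y , there y∈xs , py

  ≤ᵇ-suc : ∀ a b → (ℕ.suc a ℕ.≤ᵇ ℕ.suc b) ≡ (a ℕ.≤ᵇ b)
  ≤ᵇ-suc ℕ.zero    b = refl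
  ≤ᵇ-suc (ℕ.suc a) b = refl

  ≡ᵇ-sound : ∀ {a b} → (a ℕ.≡ᵇ b) ≡ true → a ≡ b
  ≡ᵇ-sound {a} {b} eq = ℕₚ.≡ᵇ⇒≡ a b (subst T (sym eq) _)

  ≤ᵇ-sound : ∀ {a b} → (a ℕ.≤ᵇ b) ≡ true → a ℕ.≤ b
  ≤ᵇ-sound {a} {b} eq = ℕₚ.≤ᵇ⇒≤ a b (subst T (sym eq) _)

  ≤ᵇ-complete : ∀ {a b} → a ℕ.≤ b → (a ℕ.≤ᵇ b) ≡ true
  ≤ᵇ-complete {a} {b} a≤b = dec-true (a ℕ.≤? b) a≤b

  any-cong : ∀ {A : Set} {p q : A → Bool} → p ≗ q → ∀ xs → any p xs ≡ any q xs
  any-cong p≗q []       = refl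
  any-cong p≗q (x ∷ xs) = cong₂ _∨_ (p≗q x) (any-cong p≗q xs)

  ==ᶠ⇒≡ : ∀ {m} {a b : Fin m} → (a ==ᶠ b) ≡ true → a ≡ b
  ==ᶠ⇒≡ {a = a} {b} eq with a Fin.≟ b
  ... | yes a≡b = a≡b

  ==ᶠ-refl : ∀ {m} (a : Fin m) → (a ==ᶠ a) ≡ true
  ==ᶠ-refl a = dec-true (a Fin.≟ a) refl

  ==ᶠ-≢ : ∀ {m} {a b : Fin m} → a ≢ b → (a ==ᶠ b) ≡ false
  ==ᶠ-≢ {a = a} {b} = dec-false (a Fin.≟ b)

  isMatchedTo⇒≡ : ∀ {r} (x : Maybe (Fin r)) j → isMatchedTo x j ≡ true → x ≡ just j
  isMatchedTo⇒≡ (just j′) j eq = cong just (==ᶠ⇒≡ eq)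

  isMatchedTo-just : ∀ {r} (j : Fin r) → isMatchedTo (just j) j ≡ true
  isMatchedTo-just = ==ᶠ-refl

  rightFree⇒unmatched : ∀ {n r} (M : Matching n r) j → rightFree M j ≡ true → ∀ i → M i ≢ just j
  rightFree⇒unmatched {n} M j free i Mi≡j with any (λ i → isMatchedTo (M i) j) (allFin n) in matched
  ... | false = contradiction (trans (sym matched) (any-intro _ (allFin n) (∈-allFin i)
                  (subst (λ x → isMatchedTo x j ≡ true) (sym Mi≡j) (==ᶠ-refl j)))) λ ()

  ¬rightFree⇒matched : ∀ {n r} (M : Matching n r) j → rightFree M j ≡ false → ∃ λ i → M i ≡ just j
  ¬rightFree⇒matched {n} M j taken with any (λ i → isMatchedTo (M i) j) (allFin n) in matched
  ... | true = let i , _ , Mi≡j = any-true _ (allFin n) matched in i , isMatchedTo⇒≡ (M i) j Mi≡j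

  arrivedUpTo⇒ : ∀ {n} (σ : Vec (Fin n) n) c i → arrivedUpTo σ c i ≡ true →
                 ∃ λ q → toℕ q ℕ.≤ toℕ c × lookup σ q ≡ i
  arrivedUpTo⇒ {n} σ c i arrived =
    let q , _ , q≤c∧σq≡i = any-true _ (allFin n) arrived
        q≤c , σq≡i = ∧-true q≤c∧σq≡i
    in q , ≤ᵇ-sound q≤c , ==ᶠ⇒≡ σq≡i

  arrivedUpTo-lookup : ∀ {n} (σ : Vec (Fin n) n) c q → toℕ q ℕ.≤ toℕ c → arrivedUpTo σ c (lookup σ q) ≡ true
  arrivedUpTo-lookup {n} σ c q q≤c = any-intro _ (allFin n) (∈-allFin q)
    (subst (λ b → b ∧ (lookup σ q ==ᶠ lookup σ q) ≡ true) (sym (≤ᵇ-complete q≤c)) (==ᶠ-refl (lookup σ q)))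

  module _ {n m} (σ : Vec (Fin n) m) where
    isInjective⇒injective : isInjective σ ≡ true → Injective _≡_ _≡_ (lookup σ)
    isInjective⇒injective inj {p} {q} σp≡σq
      with all-true _ (allFin m) (all-true _ (allFin m) inj (∈-allFin p)) (∈-allFin q)
    ... | distinct with lookup σ p ==ᶠ lookup σ q in σp==σq | p Fin.≟ q
    ...   | _     | yes p≡q = p≡q
    ...   | false | no _    = contradiction (trans (sym σp==σq) (trans (cong (_==ᶠ lookup σ q) σp≡σq) (==ᶠ-refl (lookup σ q)))) λ ()

    injective⇒isInjective : Injective _≡_ _≡_ (lookup σ) → isInjective σ ≡ true
    injective⇒isInjective inj with isInjective σ in notInj
    ... | true  = refl
    ... | false with all-false _ (allFin m) notInj
    ...   | p , _ , notInjₚ with all-false _ (allFin m) notInjₚ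
    ...     | q , _ , collision with lookup σ p ==ᶠ lookup σ q in σp==σq | p ==ᶠ q in p==q
    ...       | true | false = contradiction (trans (sym (==ᶠ-refl q)) (subst (λ x → (x ==ᶠ q) ≡ false) (inj (==ᶠ⇒≡ σp==σq)) p==q)) λ ()

module Arithmetic where
  open import Data.Rational
  open import Data.Rational.Properties

  ℕtoℚ≡mkℚ : ∀ m → ℕtoℚ m ≡ mkℚ (ℤ.+ m) 0 (Coprimality.sym (Coprimality.1-coprimeTo m))
  ℕtoℚ≡mkℚ m = normalize-coprime (Coprimality.sym (Coprimality.1-coprimeTo m))

  ℕtoℚ-+ : ∀ a b → ℕtoℚ (a ℕ.+ b) ≡ ℕtoℚ a + ℕtoℚ b
  ℕtoℚ-+ a b = begin
    ℤ.+ (a ℕ.+ b) / 1                              ≡⟨ cong (_/ 1) (sym (cong₂ ℤ._+_ (ℤₚ.*-identityʳ (ℤ.+ a)) (ℤₚ.*-identityʳ (ℤ.+ b)))) ⟩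
    (ℤ.+ a ℤ.* ℤ.+ 1 ℤ.+ ℤ.+ b ℤ.* ℤ.+ 1) / 1      ≡⟨ cong₂ _+_ (ℕtoℚ≡mkℚ a) (ℕtoℚ≡mkℚ b) ⟨
    ℕtoℚ a + ℕtoℚ b                                ∎
    where open ≡-Reasoning

  ℕtoℚ-* : ∀ a b → ℕtoℚ (a ℕ.* b) ≡ ℕtoℚ a * ℕtoℚ b
  ℕtoℚ-* a b = trans (cong (_/ 1) (ℤₚ.pos-* a b)) (sym (cong₂ _*_ (ℕtoℚ≡mkℚ a) (ℕtoℚ≡mkℚ b)))

  ℕtoℚ-suc : ∀ m → ℕtoℚ (ℕ.suc m) ≡ 1ℚ + ℕtoℚ m
  ℕtoℚ-suc = ℕtoℚ-+ 1

  ℕtoℚ-suc-* : ∀ m x → ℕtoℚ (ℕ.suc m) * x ≡ x + ℕtoℚ m * x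
  ℕtoℚ-suc-* m x = begin
    ℕtoℚ (ℕ.suc m) * x   ≡⟨ cong (_* x) (ℕtoℚ-suc m) ⟩
    (1ℚ + ℕtoℚ m) * x    ≡⟨ *-distribʳ-+ x 1ℚ (ℕtoℚ m) ⟩
    1ℚ * x + ℕtoℚ m * x  ≡⟨ cong (_+ ℕtoℚ m * x) (*-identityˡ x) ⟩
    x + ℕtoℚ m * x       ∎
    where open ≡-Reasoning

  ℕtoℚ-mono-≤ : ∀ {a b} → a ℕ.≤ b → ℕtoℚ a ≤ ℕtoℚ b
  ℕtoℚ-mono-≤ {a} {b} a≤b rewrite ℕtoℚ≡mkℚ a | ℕtoℚ≡mkℚ b =
    *≤* (subst₂ ℤ._≤_ (sym (ℤₚ.*-identityʳ (ℤ.+ a))) (sym (ℤₚ.*-identityʳ (ℤ.+ b))) (ℤ.+≤+ a≤b))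

  ℕtoℚ-nonNeg : ∀ m → 0ℚ ≤ ℕtoℚ m
  ℕtoℚ-nonNeg m = ℕtoℚ-mono-≤ {0} {m} ℕ.z≤n

  ℕtoℚ-suc-positive : ∀ m → Positive (ℕtoℚ (ℕ.suc m))
  ℕtoℚ-suc-positive m rewrite ℕtoℚ≡mkℚ (ℕ.suc m) = _

  ℕtoℚ-suc*1/suc : ∀ m → ℕtoℚ (ℕ.suc m) * (ℤ.+ 1 / ℕ.suc m) ≡ 1ℚ
  ℕtoℚ-suc*1/suc m rewrite ℕtoℚ≡mkℚ (ℕ.suc m) | normalize-coprime {1} {m} (Coprimality.1-coprimeTo (ℕ.suc m)) =
    *-inverseʳ (mkℚ (ℤ.+ ℕ.suc m) 0 (Coprimality.sym (Coprimality.1-coprimeTo (ℕ.suc m))))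

  *-cancelˡ-≤-suc : ∀ m {a b} → ℕtoℚ (ℕ.suc m) * a ≤ ℕtoℚ (ℕ.suc m) * b → a ≤ b
  *-cancelˡ-≤-suc m = *-cancelˡ-≤-pos (ℕtoℚ (ℕ.suc m)) {{ℕtoℚ-suc-positive m}}

  *-monoˡ-≤-0≤ : ∀ {c a b} → 0ℚ ≤ c → a ≤ b → c * a ≤ c * b
  *-monoˡ-≤-0≤ {c} 0≤c = *-monoˡ-≤-nonNeg c {{nonNegative 0≤c}}

  ℕtoℚ-*-monoˡ-≤ : ∀ m {a b} → a ≤ b → ℕtoℚ m * a ≤ ℕtoℚ m * b
  ℕtoℚ-*-monoˡ-≤ m = *-monoˡ-≤-0≤ (ℕtoℚ-nonNeg m)

  +-cancelˡ-≤ : ∀ a {b c} → a + b ≤ a + c → b ≤ c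
  +-cancelˡ-≤ a {b} {c} a+b≤a+c = subst₂ _≤_ (cancel b) (cancel c) (+-monoʳ-≤ (- a) a+b≤a+c)
    where
    cancel : ∀ x → - a + (a + x) ≡ x
    cancel x = trans (sym (+-assoc (- a) a x)) (trans (cong (_+ x) (+-inverseˡ a)) (+-identityˡ x))

  x≤y+x : ∀ {x y} → 0ℚ ≤ y → x ≤ y + x
  x≤y+x {x} {y} 0≤y = subst (_≤ y + x) (+-identityˡ x) (+-monoˡ-≤ x 0≤y)

  x≤x+y : ∀ {x y} → 0ℚ ≤ y → x ≤ x + y
  x≤x+y {x} {y} 0≤y = subst (_≤ x + y) (+-identityʳ x) (+-monoʳ-≤ x 0≤y)

  *-exchangeˡ : ∀ a b c → a * (b * c) ≡ b * (a * c)
  *-exchangeˡ a b c = trans (sym (*-assoc a b c)) (trans (cong (_* c) (*-comm a b)) (*-assoc b a c))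

  x+x≡2*x : ∀ x → x + x ≡ ℕtoℚ 2 * x
  x+x≡2*x x = trans (cong₂ _+_ (sym (*-identityˡ x)) (sym (*-identityˡ x))) (sym (*-distribʳ-+ x 1ℚ 1ℚ))

module Sums where
  open import Data.Rational
  open import Data.Rational.Properties
  open import Algebra.Properties.Semiring.Sum (CommutativeRing.semiring +-*-commutativeRing) public
    using (sum; sum-cong-≗; sum-replicate-zero; ∑-distrib-+; ∑-comm)
  open Arithmetic
  open BooleanFacts using (≤ᵇ-suc)

  ∑ : ∀ n → (Fin n → ℚ) → ℚ
  ∑ n = sum {n}

  infix 10 ∑
  syntax ∑ n (λ i → x) = ∑[ i < n ] x

  ∑-cong : ∀ n {f g : Fin n → ℚ} → (∀ i → f i ≡ g i) → ∑ n f ≡ ∑ n g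
  ∑-cong n = sum-cong-≗

  𝟙[_]_ : Bool → ℚ → ℚ
  𝟙[ b ] x = if b then x else 0ℚ

  𝟙-∧ : ∀ a b x → 𝟙[ a ∧ b ] x ≡ 𝟙[ a ] 𝟙[ b ] x
  𝟙-∧ true  b x = refl
  𝟙-∧ false b x = refl

  𝟙-comm : ∀ a b x → 𝟙[ a ] 𝟙[ b ] x ≡ 𝟙[ b ] 𝟙[ a ] x
  𝟙-comm true  b     x = refl
  𝟙-comm false true  x = refl
  𝟙-comm false false x = refl

  𝟙-nonNeg : ∀ b {x} → 0ℚ ≤ x → 0ℚ ≤ 𝟙[ b ] x
  𝟙-nonNeg true  0≤x = 0≤x
  𝟙-nonNeg false _   = ≤-refl

  𝟙≤ : ∀ b {x} → 0ℚ ≤ x → 𝟙[ b ] x ≤ x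
  𝟙≤ true  _   = ≤-refl
  𝟙≤ false 0≤x = 0≤x

  𝟙-split : ∀ a b x → 𝟙[ a ] 𝟙[ not b ] x + 𝟙[ a ] 𝟙[ b ] x ≡ 𝟙[ a ] x
  𝟙-split true  true  x = +-identityˡ x
  𝟙-split true  false x = +-identityʳ x
  𝟙-split false b     x = +-identityʳ 0ℚ

  ∑-zero : ∀ n {f : Fin n → ℚ} → (∀ i → f i ≡ 0ℚ) → ∑[ i < n ] f i ≡ 0ℚ
  ∑-zero n f≗0 = trans (∑-cong n f≗0) (sum-replicate-zero n)

  ∑-mono-≤ : ∀ n {f g : Fin n → ℚ} → (∀ i → f i ≤ g i) → ∑[ i < n ] f i ≤ ∑[ i < n ] g i
  ∑-mono-≤ ℕ.zero    f≤g = ≤-refl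
  ∑-mono-≤ (ℕ.suc n) f≤g = +-mono-≤ (f≤g zero) (∑-mono-≤ n (f≤g ∘ suc))

  ∑-nonNeg : ∀ n {f : Fin n → ℚ} → (∀ i → 0ℚ ≤ f i) → 0ℚ ≤ ∑[ i < n ] f i
  ∑-nonNeg n {f} 0≤f = subst (_≤ sum f) (∑-zero n {λ _ → 0ℚ} λ _ → refl) (∑-mono-≤ n 0≤f)

  ∑-const : ∀ n c → ∑[ i < n ] c ≡ ℕtoℚ n * c
  ∑-const ℕ.zero    c = sym (*-zeroˡ c)
  ∑-const (ℕ.suc n) c = trans (cong (c +_) (∑-const n c)) (sym (ℕtoℚ-suc-* n c))

  ∑-onlyAt : ∀ n (f : Fin n → ℚ) i → (∀ j → j ≢ i → f j ≡ 0ℚ) → ∑[ j < n ] f j ≡ f i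
  ∑-onlyAt (ℕ.suc n) f zero    f≗0 =
    trans (cong (f zero +_) (∑-zero n (λ j → f≗0 (suc j) λ ()))) (+-identityʳ (f zero))
  ∑-onlyAt (ℕ.suc n) f (suc i) f≗0 =
    trans (cong (_+ sum (f ∘ suc)) (f≗0 zero λ ()))
          (trans (+-identityˡ _) (∑-onlyAt n (f ∘ suc) i λ j j≢i → f≗0 (suc j) (j≢i ∘ Finₚ.suc-injective)))

  term≤∑ : ∀ n (f : Fin n → ℚ) i → (∀ j → 0ℚ ≤ f j) → f i ≤ ∑[ j < n ] f j
  term≤∑ (ℕ.suc n) f zero    0≤f = x≤x+y (∑-nonNeg n (0≤f ∘ suc))
  term≤∑ (ℕ.suc n) f (suc i) 0≤f = ≤-trans (term≤∑ n (f ∘ suc) i (0≤f ∘ suc)) (x≤y+x (0≤f zero))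

  ∑-𝟙-atMostOne : ∀ n (P : Fin n → Bool) {c} → (∀ q q′ → P q ≡ true → P q′ ≡ true → q ≡ q′) → 0ℚ ≤ c →
                  ∑[ q < n ] 𝟙[ P q ] c ≤ c
  ∑-𝟙-atMostOne n P {c} unique 0≤c with Finₚ.any? (λ q → P q Bool.≟ true)
  ... | yes (q₀ , Pq₀) = ≤-reflexive (trans (∑-onlyAt n _ q₀ others) (cong (𝟙[_] c) Pq₀))
    where
    others : ∀ q → q ≢ q₀ → 𝟙[ P q ] c ≡ 0ℚ
    others q q≢q₀ with P q in Pq
    ... | true  = contradiction (unique q q₀ Pq Pq₀) q≢q₀
    ... | false = refl
  ... | no none = ≤-trans (≤-reflexive (∑-zero n absent)) 0≤c
    where
    absent : ∀ q → 𝟙[ P q ] c ≡ 0ℚ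
    absent q with P q in Pq
    ... | true  = contradiction (q , Pq) none
    ... | false = refl

  ∑-𝟙-≤ : ∀ n c x → c ℕ.< n → ∑[ q < n ] 𝟙[ toℕ q ℕ.≤ᵇ c ] x ≡ ℕtoℚ (ℕ.suc c) * x
  ∑-𝟙-≤ (ℕ.suc n) ℕ.zero    x _ = trans (cong (x +_) (trans (∑-zero n λ _ → refl) (sym (*-zeroˡ x)))) (sym (ℕtoℚ-suc-* 0 x))
  ∑-𝟙-≤ (ℕ.suc n) (ℕ.suc c) x (ℕ.s≤s c<n) = begin
    x + ∑[ q < n ] 𝟙[ ℕ.suc (toℕ q) ℕ.≤ᵇ ℕ.suc c ] x  ≡⟨ cong (x +_) (∑-cong n λ q → cong (𝟙[_] x) (≤ᵇ-suc (toℕ q) c)) ⟩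
    x + ∑[ q < n ] 𝟙[ toℕ q ℕ.≤ᵇ c ] x                  ≡⟨ cong (x +_) (∑-𝟙-≤ n c x c<n) ⟩
    x + ℕtoℚ (ℕ.suc c) * x                              ≡⟨ ℕtoℚ-suc-* (ℕ.suc c) x ⟨
    ℕtoℚ (ℕ.suc (ℕ.suc c)) * x                          ∎
    where open ≡-Reasoning

  ∑ˡ : ∀ {A : Set} → (A → ℚ) → List A → ℚ
  ∑ˡ f xs = sumℚ (map f xs)

  module _ {A : Set} where
    ∑ˡ-cong : ∀ {f g : A → ℚ} → (∀ x → f x ≡ g x) → ∀ xs → ∑ˡ f xs ≡ ∑ˡ g xs
    ∑ˡ-cong f≗g []       = refl
    ∑ˡ-cong f≗g (x ∷ xs) = cong₂ _+_ (f≗g x) (∑ˡ-cong f≗g xs)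

    ∑ˡ-mono-≤ : ∀ {f g : A → ℚ} → (∀ x → f x ≤ g x) → ∀ xs → ∑ˡ f xs ≤ ∑ˡ g xs
    ∑ˡ-mono-≤ f≤g []       = ≤-refl
    ∑ˡ-mono-≤ f≤g (x ∷ xs) = +-mono-≤ (f≤g x) (∑ˡ-mono-≤ f≤g xs)

    ∑ˡ-zero : ∀ xs → ∑ˡ (λ (_ : A) → 0ℚ) xs ≡ 0ℚ
    ∑ˡ-zero []       = refl
    ∑ˡ-zero (x ∷ xs) = trans (+-identityˡ _) (∑ˡ-zero xs)

    *-distribˡ-∑ˡ : ∀ c (f : A → ℚ) xs → c * ∑ˡ f xs ≡ ∑ˡ (λ x → c * f x) xs
    *-distribˡ-∑ˡ c f []       = *-zeroʳ c
    *-distribˡ-∑ˡ c f (x ∷ xs) = trans (*-distribˡ-+ c (f x) _) (cong (c * f x +_) (*-distribˡ-∑ˡ c f xs))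

    𝟙-∑ˡ : ∀ b (f : A → ℚ) xs → ∑ˡ (λ x → 𝟙[ b ] f x) xs ≡ 𝟙[ b ] ∑ˡ f xs
    𝟙-∑ˡ true  f xs = refl
    𝟙-∑ˡ false f xs = ∑ˡ-zero xs

    ∑ˡ-++ : ∀ (f : A → ℚ) xs ys → ∑ˡ f (xs ++ ys) ≡ ∑ˡ f xs + ∑ˡ f ys
    ∑ˡ-++ f []       ys = sym (+-identityˡ _)
    ∑ˡ-++ f (x ∷ xs) ys = trans (cong (f x +_) (∑ˡ-++ f xs ys)) (sym (+-assoc (f x) _ _))

    ∑ˡ-filter : ∀ (f : A → ℚ) {P : A → Set} (P? : Decidable P) xs →
                ∑ˡ f (filter P? xs) ≡ ∑ˡ (λ x → 𝟙[ does (P? x) ] f x) xs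
    ∑ˡ-filter f P? []       = refl
    ∑ˡ-filter f P? (x ∷ xs) with does (P? x)
    ... | true  = cong (f x +_) (∑ˡ-filter f P? xs)
    ... | false = trans (∑ˡ-filter f P? xs) (sym (+-identityˡ _))

    ∑ˡ-∑-comm : ∀ n (f : A → Fin n → ℚ) xs → ∑ˡ (λ x → ∑[ i < n ] f x i) xs ≡ ∑[ i < n ] ∑ˡ (λ x → f x i) xs
    ∑ˡ-∑-comm n f []       = sym (∑-zero n λ _ → refl)
    ∑ˡ-∑-comm n f (x ∷ xs) =
      trans (cong (sum (f x) +_) (∑ˡ-∑-comm n f xs)) (sym (∑-distrib-+ (f x) (λ i → ∑ˡ (λ x → f x i) xs)))

  module _ {A B : Set} where
    ∑ˡ-map : ∀ (f : B → ℚ) (g : A → B) xs → ∑ˡ f (map g xs) ≡ ∑ˡ (f ∘ g) xs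
    ∑ˡ-map f g []       = refl
    ∑ˡ-map f g (x ∷ xs) = cong (f (g x) +_) (∑ˡ-map f g xs)

    ∑ˡ-concatMap : ∀ (f : B → ℚ) (g : A → List B) xs → ∑ˡ f (concatMap g xs) ≡ ∑ˡ (λ x → ∑ˡ f (g x)) xs
    ∑ˡ-concatMap f g []       = refl
    ∑ˡ-concatMap f g (x ∷ xs) = trans (∑ˡ-++ f (g x) (concatMap g xs)) (cong (∑ˡ f (g x) +_) (∑ˡ-concatMap f g xs))

  ∑ˡ-tabulate : ∀ {A : Set} n (f : A → ℚ) (g : Fin n → A) → ∑ˡ f (tabulate g) ≡ ∑[ i < n ] f (g i)
  ∑ˡ-tabulate ℕ.zero    f g = refl
  ∑ˡ-tabulate (ℕ.suc n) f g = cong (f (g zero) +_) (∑ˡ-tabulate n f (g ∘ suc))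

  ∑ˡ-allFin : ∀ n (f : Fin n → ℚ) → ∑ˡ f (allFin n) ≡ ∑[ i < n ] f i
  ∑ˡ-allFin n f = ∑ˡ-tabulate n f id

module Greedy where
  open BooleanFacts

  module _ {n r : ℕ} where
    _⊆ₘ_ : Matching n r → Matching n r → Set
    M ⊆ₘ M′ = ∀ i j → M i ≡ just j → M′ i ≡ just j

    ⊆ₘ-trans : ∀ {M M′ M″} → M ⊆ₘ M′ → M′ ⊆ₘ M″ → M ⊆ₘ M″
    ⊆ₘ-trans M⊆M′ M′⊆M″ i j = M′⊆M″ i j ∘ M⊆M′ i j

    update-≡ : ∀ (M : Matching n r) i j → update M i j i ≡ just j
    update-≡ M i j rewrite ==ᶠ-refl i = refl

    update⁻ : ∀ (M : Matching n r) i₀ j₀ i j → update M i₀ j₀ i ≡ just j →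
              (i ≡ i₀ × j ≡ j₀) ⊎ M i ≡ just j
    update⁻ M i₀ j₀ i j eq with i Fin.≟ i₀
    update⁻ M i₀ j₀ i j refl | yes refl = inj₁ (refl , refl)
    ... | no _ = inj₂ eq

    update-⊇ : ∀ (M : Matching n r) i₀ j₀ → M i₀ ≡ nothing → M ⊆ₘ update M i₀ j₀
    update-⊇ M i₀ j₀ free i j eq with i Fin.≟ i₀
    ... | yes refl = contradiction (trans (sym free) eq) λ ()
    ... | no _     = eq

    rightFree-cong : ∀ {M M′ : Matching n r} → M ≗ M′ → ∀ j → rightFree M j ≡ rightFree M′ j
    rightFree-cong M≗M′ j = cong not (any-cong (λ i → cong (λ x → isMatchedTo x j) (M≗M′ i)) (allFin n))

    foldl-cong : ∀ {A : Set} {f g : Matching n r → A → Matching n r} →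
                 (∀ {M M′} x → M ≗ M′ → f M x ≗ g M′ x) → ∀ xs {M M′} → M ≗ M′ → foldl f M xs ≗ foldl g M′ xs
    foldl-cong f≗g []       M≗M′ = M≗M′
    foldl-cong f≗g (x ∷ xs) M≗M′ = foldl-cong f≗g xs (f≗g x M≗M′)

  module _ {n r : ℕ} (adj : Adj n r) (rank : Rank n r) where
    Dominated : Matching n r → Fin n → Fin r → Set
    Dominated M i j = (∃ λ j′ → M i ≡ just j′ × rank i j ℕ.≤ rank i j′)
                    ⊎ (∃ λ i′ → M i′ ≡ just j × rank i j ℕ.≤ rank i′ j)

    Dominated-⊆ₘ : ∀ {M M′ i j} → M ⊆ₘ M′ → Dominated M i j → Dominated M′ i j
    Dominated-⊆ₘ M⊆M′ (inj₁ (j′ , eq , ≤rank)) = inj₁ (j′ , M⊆M′ _ _ eq , ≤rank)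
    Dominated-⊆ₘ M⊆M′ (inj₂ (i′ , eq , ≤rank)) = inj₂ (i′ , M⊆M′ _ _ eq , ≤rank)

    EdgesOfRank≥ : (Fin n → Bool) → ℕ → Matching n r → Set
    EdgesOfRank≥ S K M = ∀ i j → M i ≡ just j → adj i j ≡ true × S i ≡ true × K ℕ.≤ rank i j

    RightInjective : Matching n r → Set
    RightInjective M = ∀ i i′ j → M i ≡ just j → M i′ ≡ just j → i ≡ i′

    DominatesRank≥ : (Fin n → Bool) → ℕ → Matching n r → Set
    DominatesRank≥ S K M = ∀ i j → S i ≡ true → adj i j ≡ true → K ℕ.≤ rank i j → Dominated M i j

    Invariant : (Fin n → Bool) → ℕ → Matching n r → Set
    Invariant S K M = EdgesOfRank≥ S K M × RightInjective M

    -- Definitionally the scan step local to greedyStep.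
    consider : (Fin n → Bool) → ℕ → Matching n r → Fin n × Fin r → Matching n r
    consider S k M (i , j) =
      if S i ∧ adj i j ∧ does (rank i j ℕ.≟ k) ∧ isFree (M i) ∧ rightFree M j
      then update M i j else M

    ConsiderSpec : (Fin n → Bool) → ℕ → Matching n r → Fin n → Fin r → Matching n r → Set
    ConsiderSpec S k M i j M′ =
      M ⊆ₘ M′ × Invariant S k M′ × (S i ≡ true → adj i j ≡ true → rank i j ≡ k → Dominated M′ i j)

    consider-spec : ∀ S k M i j → Invariant S k M → ConsiderSpec S k M i j (consider S k M (i , j))
    consider-spec S k M i₀ j₀ inv@(edges , rightInj)
      with S i₀ in i₀∈S | adj i₀ j₀ in edge | rank i₀ j₀ ℕ.≡ᵇ k in rank≡k | M i₀ in Mi₀ | rightFree M j₀ in j₀free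
    ... | false | _     | _     | _       | _ = (λ _ _ → id) , inv , λ ()
    ... | true  | false | _     | _       | _ = (λ _ _ → id) , inv , λ _ ()
    ... | true  | true  | false | _       | _ = (λ _ _ → id) , inv ,
          λ _ _ rank≡ → contradiction (trans (sym (dec-true (rank i₀ j₀ ℕ.≟ k) rank≡)) rank≡k) λ ()
    ... | true  | true  | true  | just j′ | _ = (λ _ _ → id) , inv ,
          λ _ _ _ → inj₁ (j′ , Mi₀ , subst (ℕ._≤ rank i₀ j′) (sym (≡ᵇ-sound rank≡k)) (proj₂ (proj₂ (edges i₀ j′ Mi₀))))
    ... | true  | true  | true  | nothing | false = (λ _ _ → id) , inv ,
          λ _ _ _ → let i′ , Mi′ = ¬rightFree⇒matched M j₀ j₀free in
                    inj₂ (i′ , Mi′ , subst (ℕ._≤ rank i′ j₀) (sym (≡ᵇ-sound rank≡k)) (proj₂ (proj₂ (edges i′ j₀ Mi′))))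
    ... | true  | true  | true  | nothing | true =
          update-⊇ M i₀ j₀ Mi₀ , (edges′ , rightInj′) , λ _ _ _ → inj₁ (j₀ , update-≡ M i₀ j₀ , ℕₚ.≤-refl)
      where
      edges′ : EdgesOfRank≥ S k (update M i₀ j₀)
      edges′ i j eq with update⁻ M i₀ j₀ i j eq
      ... | inj₁ (refl , refl) = edge , i₀∈S , ℕₚ.≤-reflexive (sym (≡ᵇ-sound rank≡k))
      ... | inj₂ Mi≡j          = edges i j Mi≡j
      rightInj′ : RightInjective (update M i₀ j₀)
      rightInj′ i i′ j eq eq′ with update⁻ M i₀ j₀ i j eq | update⁻ M i₀ j₀ i′ j eq′
      ... | inj₁ (refl , _)    | inj₁ (refl , _)    = refl
      ... | inj₁ (refl , refl) | inj₂ Mi′≡j         = contradiction Mi′≡j (rightFree⇒unmatched M j₀ j₀free i′)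
      ... | inj₂ Mi≡j          | inj₁ (refl , refl) = contradiction Mi≡j (rightFree⇒unmatched M j₀ j₀free i)
      ... | inj₂ Mi≡j          | inj₂ Mi′≡j         = rightInj i i′ j Mi≡j Mi′≡j

    scan-invariant : ∀ S k xs M → Invariant S k M → M ⊆ₘ foldl (consider S k) M xs × Invariant S k (foldl (consider S k) M xs)
    scan-invariant S k []             M inv = (λ _ _ → id) , inv
    scan-invariant S k ((i , j) ∷ xs) M inv =
      let M⊆M′ , inv′ , _ = consider-spec S k M i j inv
          M′⊆M″ , inv″    = scan-invariant S k xs (consider S k M (i , j)) inv′
      in ⊆ₘ-trans M⊆M′ M′⊆M″ , inv″

    scan-dominates : ∀ S k xs M i j → Invariant S k M → (i , j) ∈ xs →
                     S i ≡ true → adj i j ≡ true → rank i j ≡ k → Dominated (foldl (consider S k) M xs) i j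
    scan-dominates S k ((i₀ , j₀) ∷ xs) M i j inv (here refl) i∈S edge rank≡k =
      let _ , inv′ , dominated = consider-spec S k M i₀ j₀ inv
      in Dominated-⊆ₘ (proj₁ (scan-invariant S k xs _ inv′)) (dominated i∈S edge rank≡k)
    scan-dominates S k ((i₀ , j₀) ∷ xs) M i j inv (there ij∈xs) =
      scan-dominates S k xs _ i j (proj₁ (proj₂ (consider-spec S k M i₀ j₀ inv))) ij∈xs

    ∈-allPairs : ∀ i j → (i , j) ∈ allPairs n r
    ∈-allPairs i j = ∈-concatMap⁺ (λ i → map (i ,_) (allFin r)) (Any.map (λ { refl → ∈-map⁺ (i ,_) (∈-allFin j) }) (∈-allFin i))

    Invariant-suc : ∀ {S K M} → Invariant S (ℕ.suc K) M → Invariant S K M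
    Invariant-suc (edges , rightInj) = (λ i j eq → let e , s , K<rank = edges i j eq in e , s , ℕₚ.<⇒≤ K<rank) , rightInj

    greedyStep-invariant : ∀ S K M → Invariant S (ℕ.suc K) M → DominatesRank≥ S (ℕ.suc K) M →
      Invariant S K (greedyStep adj rank S M K) × DominatesRank≥ S K (greedyStep adj rank S M K)
    greedyStep-invariant S K M inv dominates = inv′ , dominates′
      where
      inv′ : Invariant S K (greedyStep adj rank S M K)
      inv′ = proj₂ (scan-invariant S K (allPairs n r) M (Invariant-suc inv))
      dominates′ : DominatesRank≥ S K (greedyStep adj rank S M K)
      dominates′ i j i∈S edge K≤rank with rank i j ℕ.≟ K
      ... | yes rank≡K = scan-dominates S K (allPairs n r) M i j (Invariant-suc inv) (∈-allPairs i j) i∈S edge rank≡K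
      ... | no rank≢K  = Dominated-⊆ₘ (proj₁ (scan-invariant S K (allPairs n r) M (Invariant-suc inv)))
                           (dominates i j i∈S edge (ℕₚ.≤∧≢⇒< K≤rank (rank≢K ∘ sym)))

    greedySteps-invariant : ∀ S K M → Invariant S K M → DominatesRank≥ S K M →
      let M′ = foldl (greedyStep adj rank S) M (downFrom K) in Invariant S 0 M′ × DominatesRank≥ S 0 M′
    greedySteps-invariant S ℕ.zero    M inv dominates = inv , dominates
    greedySteps-invariant S (ℕ.suc K) M inv dominates =
      let inv′ , dominates′ = greedyStep-invariant S K M inv dominates
      in greedySteps-invariant S K (greedyStep adj rank S M K) inv′ dominates′

    rank≤maxRank : ∀ i j → rank i j ℕ.≤ maxRank rank
    rank≤maxRank i j = foldr-⊔-bound (allPairs n r) (∈-allPairs i j)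
      where
      foldr-⊔-bound : ∀ xs {i j} → (i , j) ∈ xs → rank i j ℕ.≤ foldr (λ { (i , j) acc → rank i j ℕ.⊔ acc }) 0 xs
      foldr-⊔-bound ((i , j) ∷ xs) (here refl)  = ℕₚ.m≤m⊔n (rank i j) _
      foldr-⊔-bound ((i , j) ∷ xs) (there ij∈xs) = ℕₚ.≤-trans (foldr-⊔-bound xs ij∈xs) (ℕₚ.m≤n⊔m (rank i j) _)

    greedy-invariant : ∀ S → Invariant S 0 (greedy adj rank S) × DominatesRank≥ S 0 (greedy adj rank S)
    greedy-invariant S = greedySteps-invariant S (ℕ.suc (maxRank rank)) emptyM ((λ _ _ ()) , λ _ _ _ ())
      λ i j _ _ max<rank → contradiction max<rank (ℕₚ.<⇒≱ (ℕ.s≤s (rank≤maxRank i j)))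

    greedy-edge : ∀ S i j → greedy adj rank S i ≡ just j → adj i j ≡ true × S i ≡ true
    greedy-edge S i j eq = let e , s , _ = proj₁ (proj₁ (greedy-invariant S)) i j eq in e , s

    greedy-rightInjective : ∀ S → RightInjective (greedy adj rank S)
    greedy-rightInjective S = proj₂ (proj₁ (greedy-invariant S))

    greedy-dominates : ∀ S i j → S i ≡ true → adj i j ≡ true → Dominated (greedy adj rank S) i j
    greedy-dominates S i j i∈S edge = proj₂ (greedy-invariant S) i j i∈S edge ℕ.z≤n

    consider-cong : ∀ {S S′} k → S ≗ S′ → ∀ {M M′} x → M ≗ M′ → consider S k M x ≗ consider S′ k M′ x
    consider-cong {S} {S′} k S≗S′ {M} {M′} (i₀ , j₀) M≗M′ i
      rewrite S≗S′ i₀ | M≗M′ i₀ | rightFree-cong M≗M′ j₀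
      with S′ i₀ ∧ adj i₀ j₀ ∧ does (rank i₀ j₀ ℕ.≟ k) ∧ isFree (M′ i₀) ∧ rightFree M′ j₀
    ... | true  = cong (if i ==ᶠ i₀ then just j₀ else_) (M≗M′ i)
    ... | false = M≗M′ i

    greedy-cong : ∀ {S S′} → S ≗ S′ → greedy adj rank S ≗ greedy adj rank S′
    greedy-cong S≗S′ = foldl-cong (λ k → foldl-cong (consider-cong k S≗S′) (allPairs n r))
                                  (downFrom (ℕ.suc (maxRank rank))) (λ _ → refl)

module WeightFacts where
  open import Data.Rational using (ℚ; 0ℚ; _≤_)
  open import Data.Rational.Properties using (≤-refl)

  module _ {n r} (w : Weights n r) (M : Matching n r) where
    weightAt-just : ∀ i j → M i ≡ just j → weightAt w M i ≡ w i j
    weightAt-just i j eq with M i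
    weightAt-just i j refl | just .j = refl

    weightAt-nothing : ∀ i → M i ≡ nothing → weightAt w M i ≡ 0ℚ
    weightAt-nothing i eq with M i
    weightAt-nothing i refl | nothing = refl

    weightAt-cong : ∀ {M′ : Matching n r} i → M i ≡ M′ i → weightAt w M i ≡ weightAt w M′ i
    weightAt-cong {M′} i Mi≡M′i with M i | M′ i
    weightAt-cong i refl | nothing | .nothing = refl
    weightAt-cong i refl | just j  | .(just j) = refl

    weightAt-nonNeg : ∀ {adj} → NonNegWeights adj w → (∀ i j → M i ≡ just j → adj i j ≡ true) → ∀ i → 0ℚ ≤ weightAt w M i
    weightAt-nonNeg nonNeg edges i with M i in eq
    ... | nothing = ≤-refl
    ... | just j  = nonNeg i j (edges i j eq)

module HalfApproximation {n r : ℕ} (adj : Adj n r) (w : Weights n r) (rank : Rank n r)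
  (nonNeg : NonNegWeights adj w) (order : IsEdgeOrder adj w rank) where
  open import Data.Rational using (ℚ; 0ℚ; _+_; _≤_)
  open import Data.Rational.Properties
  open Arithmetic
  open Sums
  open BooleanFacts
  open Greedy
  open WeightFacts

  rank-mono-weight : ∀ i j i′ j′ → adj i j ≡ true → adj i′ j′ ≡ true → rank i j ℕ.≤ rank i′ j′ → w i j ≤ w i′ j′
  rank-mono-weight i j i′ j′ e e′ rank≤ = ≮⇒≥ (λ w< → ℕₚ.<⇒≱ (proj₂ order i′ i j′ j e′ e w<) rank≤)

  module _ (Ms : Matching n r) (Ms-matching : IsMatching adj Ms) (S : Fin n → Bool) where
    G : Matching n r
    G = greedy adj rank S

    weightG-nonNeg : ∀ i → 0ℚ ≤ weightAt w G i
    weightG-nonNeg = weightAt-nonNeg w G nonNeg (λ i j → proj₁ ∘ greedy-edge adj rank S i j)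

    -- An edge (i , j) of Ms inside S is dominated by a greedy edge at i or at j; in the second
    -- case it is charged to the greedy edge at j, which happens for at most one i.
    charge : Maybe (Fin r) → Fin n → Maybe (Fin r) → ℚ
    charge m i′ nothing  = 0ℚ
    charge m i′ (just j) = 𝟙[ isMatchedTo m j ] w i′ j

    chargeVia : Fin n → Fin n → ℚ
    chargeVia i i′ = charge (Ms i) i′ (G i′)

    chargeVia-nonNeg : ∀ i i′ → 0ℚ ≤ chargeVia i i′
    chargeVia-nonNeg i i′ with G i′ in Gi′
    ... | nothing = ≤-refl
    ... | just j  = 𝟙-nonNeg (isMatchedTo (Ms i) j) (nonNeg i′ j (proj₁ (greedy-edge adj rank S i′ j Gi′)))

    chargeVia-self : ∀ i i′ j → Ms i ≡ just j → G i′ ≡ just j → chargeVia i i′ ≡ w i′ j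
    chargeVia-self i i′ j Msi Gi′ rewrite Msi | Gi′ | isMatchedTo-just j = refl

    0≤greedy+charges : ∀ i → 0ℚ ≤ weightAt w G i + ∑[ i′ < n ] chargeVia i i′
    0≤greedy+charges i = ≤-trans (weightG-nonNeg i) (x≤x+y (∑-nonNeg n (chargeVia-nonNeg i)))

    optimal≤greedy+charges : ∀ i → 𝟙[ S i ] weightAt w Ms i ≤ weightAt w G i + ∑[ i′ < n ] chargeVia i i′
    optimal≤greedy+charges i with S i in i∈S
    ... | false = 0≤greedy+charges i
    ... | true  = bound (Ms i) refl
      where
      bound : ∀ m → Ms i ≡ m → weightAt w Ms i ≤ weightAt w G i + ∑[ i′ < n ] chargeVia i i′
      bound nothing Msi rewrite weightAt-nothing w Ms i Msi = 0≤greedy+charges i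
      bound (just j) Msi rewrite weightAt-just w Ms i j Msi with greedy-dominates adj rank S i j i∈S (proj₁ Ms-matching i j Msi)
      ... | inj₁ (j′ , Gi , rank≤) = ≤-trans
              (rank-mono-weight i j i j′ (proj₁ Ms-matching i j Msi) (proj₁ (greedy-edge adj rank S i j′ Gi)) rank≤)
              (subst (λ x → w i j′ ≤ x + ∑ n (chargeVia i)) (sym (weightAt-just w G i j′ Gi)) (x≤x+y (∑-nonNeg n (chargeVia-nonNeg i))))
      ... | inj₂ (i′ , Gi′ , rank≤) = ≤-trans
              (rank-mono-weight i j i′ j (proj₁ Ms-matching i j Msi) (proj₁ (greedy-edge adj rank S i′ j Gi′)) rank≤)
              (≤-trans (≤-reflexive (sym (chargeVia-self i i′ j Msi Gi′)))
                       (≤-trans (term≤∑ n (chargeVia i) i′ (chargeVia-nonNeg i)) (x≤y+x (weightG-nonNeg i))))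

    charges≤greedy : ∀ i′ → ∑[ i < n ] chargeVia i i′ ≤ weightAt w G i′
    charges≤greedy i′ with G i′ in Gi′
    ... | nothing = ≤-reflexive (∑-zero n λ _ → refl)
    ... | just j  = ∑-𝟙-atMostOne n (λ i → isMatchedTo (Ms i) j)
      (λ i i₀ Msi Msi₀ → proj₂ Ms-matching i i₀ j (isMatchedTo⇒≡ (Ms i) j Msi) (isMatchedTo⇒≡ (Ms i₀) j Msi₀))
      (nonNeg i′ j (proj₁ (greedy-edge adj rank S i′ j Gi′)))

    greedy-halfApproximation : ∑[ i < n ] 𝟙[ S i ] weightAt w Ms i ≤ weight w G + weight w G
    greedy-halfApproximation = begin
      ∑[ i < n ] 𝟙[ S i ] weightAt w Ms i
        ≤⟨ ∑-mono-≤ n optimal≤greedy+charges ⟩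
      ∑[ i < n ] (weightAt w G i + ∑[ i′ < n ] chargeVia i i′)
        ≡⟨ ∑-distrib-+ (weightAt w G) _ ⟩
      ∑[ i < n ] weightAt w G i + ∑[ i < n ] ∑[ i′ < n ] chargeVia i i′
        ≡⟨ cong (∑ n (weightAt w G) +_) (∑-comm chargeVia) ⟩
      ∑[ i < n ] weightAt w G i + ∑[ i′ < n ] ∑[ i < n ] chargeVia i i′
        ≤⟨ +-monoʳ-≤ (∑ n (weightAt w G)) (∑-mono-≤ n charges≤greedy) ⟩
      ∑[ i < n ] weightAt w G i + ∑[ i < n ] weightAt w G i
        ≡⟨ cong₂ _+_ (∑ˡ-allFin n (weightAt w G)) (∑ˡ-allFin n (weightAt w G)) ⟨
      weight w G + weight w G ∎
      where open ≤-Reasoning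

module ArrivalOrders where
  open import Data.Rational using (ℚ; 0ℚ; 1ℚ; _+_; _*_; _/_; _≤_; Positive)
  open import Data.Rational.Properties using (≤-refl; *-zeroʳ; *-comm; *-identityʳ)
  open Arithmetic
  open Sums
  open BooleanFacts

  IsPermutation : ∀ {n} → Vec (Fin n) n → Set
  IsPermutation σ = Injective _≡_ _≡_ (lookup σ)

  -- The transposition of positions i and i + 1; the identity when i + 1 ≥ m.
  swapIndex : ∀ {m} → ℕ → Fin m → Fin m
  swapIndex {ℕ.suc ℕ.zero}    ℕ.zero    zero          = zero
  swapIndex {ℕ.suc (ℕ.suc m)} ℕ.zero    zero          = suc zero
  swapIndex {ℕ.suc (ℕ.suc m)} ℕ.zero    (suc zero)    = zero
  swapIndex {ℕ.suc (ℕ.suc m)} ℕ.zero    (suc (suc p)) = suc (suc p)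
  swapIndex                   (ℕ.suc i) zero          = zero
  swapIndex                   (ℕ.suc i) (suc p)       = suc (swapIndex i p)

  swapAt : ∀ {A : Set} {m} → ℕ → Vec A m → Vec A m
  swapAt ℕ.zero    []          = []
  swapAt ℕ.zero    (x ∷ [])    = x ∷ []
  swapAt ℕ.zero    (x ∷ y ∷ v) = y ∷ x ∷ v
  swapAt (ℕ.suc i) []          = []
  swapAt (ℕ.suc i) (x ∷ v)     = x ∷ swapAt i v

  lookup-swapAt : ∀ {A : Set} {m} i (v : Vec A m) p → lookup (swapAt i v) p ≡ lookup v (swapIndex i p)
  lookup-swapAt ℕ.zero    (x ∷ [])    zero          = refl
  lookup-swapAt ℕ.zero    (x ∷ y ∷ v) zero          = refl
  lookup-swapAt ℕ.zero    (x ∷ y ∷ v) (suc zero)    = refl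
  lookup-swapAt ℕ.zero    (x ∷ y ∷ v) (suc (suc p)) = refl
  lookup-swapAt (ℕ.suc i) (x ∷ v)     zero          = refl
  lookup-swapAt (ℕ.suc i) (x ∷ v)     (suc p)       = lookup-swapAt i v p

  swapIndex-involutive : ∀ {m} i (p : Fin m) → swapIndex i (swapIndex i p) ≡ p
  swapIndex-involutive {ℕ.suc ℕ.zero}    ℕ.zero    zero          = refl
  swapIndex-involutive {ℕ.suc (ℕ.suc m)} ℕ.zero    zero          = refl
  swapIndex-involutive {ℕ.suc (ℕ.suc m)} ℕ.zero    (suc zero)    = refl
  swapIndex-involutive {ℕ.suc (ℕ.suc m)} ℕ.zero    (suc (suc p)) = refl
  swapIndex-involutive {ℕ.suc m}         (ℕ.suc i) zero          = refl
  swapIndex-involutive {ℕ.suc m}         (ℕ.suc i) (suc p)       = cong suc (swapIndex-involutive i p)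

  swapIndex-beyond : ∀ {m} i (p : Fin m) → ℕ.suc i ℕ.< toℕ p → swapIndex i p ≡ p
  swapIndex-beyond {ℕ.suc (ℕ.suc m)} ℕ.zero    (suc zero)    (ℕ.s≤s ())
  swapIndex-beyond {ℕ.suc (ℕ.suc m)} ℕ.zero    (suc (suc p)) _           = refl
  swapIndex-beyond {ℕ.suc m}         (ℕ.suc i) (suc p)       (ℕ.s≤s i<p) = cong suc (swapIndex-beyond i p i<p)

  swapIndex-≤ : ∀ {m} i (p : Fin m) c → ℕ.suc i ℕ.≤ c → toℕ p ℕ.≤ c → toℕ (swapIndex i p) ℕ.≤ c
  swapIndex-≤ {ℕ.suc ℕ.zero}    ℕ.zero    zero          c i<c p≤c = p≤c
  swapIndex-≤ {ℕ.suc (ℕ.suc m)} ℕ.zero    zero          c i<c p≤c = i<c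
  swapIndex-≤ {ℕ.suc (ℕ.suc m)} ℕ.zero    (suc zero)    c i<c p≤c = ℕ.z≤n
  swapIndex-≤ {ℕ.suc (ℕ.suc m)} ℕ.zero    (suc (suc p)) c i<c p≤c = p≤c
  swapIndex-≤ {ℕ.suc m}         (ℕ.suc i) zero          c i<c p≤c = ℕ.z≤n
  swapIndex-≤ {ℕ.suc m} (ℕ.suc i) (suc p) (ℕ.suc c) (ℕ.s≤s i<c) (ℕ.s≤s p≤c) = ℕ.s≤s (swapIndex-≤ i p c i<c p≤c)

  swapIndex-suc : ∀ {m} i (p : Fin m) → toℕ p ≡ ℕ.suc i → toℕ (swapIndex i p) ≡ i
  swapIndex-suc {ℕ.suc (ℕ.suc m)} ℕ.zero    (suc zero) _   = refl
  swapIndex-suc {ℕ.suc m}         (ℕ.suc i) (suc p)    p≡i = cong ℕ.suc (swapIndex-suc i p (ℕₚ.suc-injective p≡i))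

  injective-reindexed : ∀ {A : Set} {m} {u v : Vec A m} (π : Fin m → Fin m) → (∀ p → π (π p) ≡ p) →
    (∀ p → lookup u p ≡ lookup v (π p)) → Injective _≡_ _≡_ (lookup v) → Injective _≡_ _≡_ (lookup u)
  injective-reindexed {u = u} {v} π π-involutive u≡v∘π v-injective {p} {q} up≡uq =
    trans (sym (π-involutive p)) (trans (cong π (v-injective (trans (sym (u≡v∘π p)) (trans up≡uq (u≡v∘π q))))) (π-involutive q))

  lookup-swapAt′ : ∀ {A : Set} {m} i (v : Vec A m) p → lookup v p ≡ lookup (swapAt i v) (swapIndex i p)
  lookup-swapAt′ i v p = trans (cong (lookup v) (sym (swapIndex-involutive i p))) (sym (lookup-swapAt i v (swapIndex i p)))

  isInjective-swapAt : ∀ {n m} i (v : Vec (Fin n) m) → isInjective (swapAt i v) ≡ isInjective v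
  isInjective-swapAt i v = ≡-from-⇔true
    (λ inj′ → injective⇒isInjective v (injective-reindexed {u = v} {swapAt i v} (swapIndex i) (swapIndex-involutive i)
                 (lookup-swapAt′ i v) (isInjective⇒injective (swapAt i v) inj′)))
    (λ inj → injective⇒isInjective (swapAt i v) (injective-reindexed {u = swapAt i v} {v} (swapIndex i) (swapIndex-involutive i)
                 (lookup-swapAt i v) (isInjective⇒injective v inj)))

  ∑ˡ-allVecs-suc : ∀ n m (g : Vec (Fin n) (ℕ.suc m) → ℚ) →
                   ∑ˡ g (allVecs n (ℕ.suc m)) ≡ ∑[ x < n ] ∑ˡ (g ∘ (x ∷_)) (allVecs n m)
  ∑ˡ-allVecs-suc n m g = begin
    ∑ˡ g (allVecs n (ℕ.suc m))                            ≡⟨ ∑ˡ-concatMap g (λ x → map (x ∷_) (allVecs n m)) (allFin n) ⟩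
    ∑ˡ (λ x → ∑ˡ g (map (x ∷_) (allVecs n m))) (allFin n) ≡⟨ ∑ˡ-cong (λ x → ∑ˡ-map g (x ∷_) (allVecs n m)) (allFin n) ⟩
    ∑ˡ (λ x → ∑ˡ (g ∘ (x ∷_)) (allVecs n m)) (allFin n)   ≡⟨ ∑ˡ-allFin n _ ⟩
    ∑[ x < n ] ∑ˡ (g ∘ (x ∷_)) (allVecs n m)              ∎
    where open ≡-Reasoning

  ∑ˡ-allVecs-swapAt : ∀ n m (g : Vec (Fin n) m → ℚ) i → ∑ˡ (g ∘ swapAt i) (allVecs n m) ≡ ∑ˡ g (allVecs n m)
  ∑ˡ-allVecs-swapAt n ℕ.zero          g ℕ.zero    = refl
  ∑ˡ-allVecs-swapAt n ℕ.zero          g (ℕ.suc i) = refl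
  ∑ˡ-allVecs-swapAt n (ℕ.suc ℕ.zero)  g ℕ.zero    = ∑ˡ-cong (λ { (x ∷ []) → refl }) (allVecs n 1)
  ∑ˡ-allVecs-swapAt n (ℕ.suc (ℕ.suc m)) g ℕ.zero  = begin
    ∑ˡ (g ∘ swapAt 0) (allVecs n (ℕ.suc (ℕ.suc m)))
      ≡⟨ ∑ˡ-allVecs-suc n (ℕ.suc m) (g ∘ swapAt 0) ⟩
    ∑[ x < n ] ∑ˡ (g ∘ swapAt 0 ∘ (x ∷_)) (allVecs n (ℕ.suc m))
      ≡⟨ ∑-cong n (λ x → ∑ˡ-allVecs-suc n m (g ∘ swapAt 0 ∘ (x ∷_))) ⟩
    ∑[ x < n ] ∑[ y < n ] ∑ˡ (λ u → g (y ∷ x ∷ u)) (allVecs n m)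
      ≡⟨ ∑-comm (λ x y → ∑ˡ (λ u → g (y ∷ x ∷ u)) (allVecs n m)) ⟩
    ∑[ y < n ] ∑[ x < n ] ∑ˡ (λ u → g (y ∷ x ∷ u)) (allVecs n m)
      ≡⟨ ∑-cong n (λ y → ∑ˡ-allVecs-suc n m (g ∘ (y ∷_))) ⟨
    ∑[ y < n ] ∑ˡ (g ∘ (y ∷_)) (allVecs n (ℕ.suc m))
      ≡⟨ ∑ˡ-allVecs-suc n (ℕ.suc m) g ⟨
    ∑ˡ g (allVecs n (ℕ.suc (ℕ.suc m)))
      ∎
    where open ≡-Reasoning
  ∑ˡ-allVecs-swapAt n (ℕ.suc m) g (ℕ.suc i) = begin
    ∑ˡ (g ∘ swapAt (ℕ.suc i)) (allVecs n (ℕ.suc m))          ≡⟨ ∑ˡ-allVecs-suc n m (g ∘ swapAt (ℕ.suc i)) ⟩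
    ∑[ x < n ] ∑ˡ (g ∘ (x ∷_) ∘ swapAt i) (allVecs n m)      ≡⟨ ∑-cong n (λ x → ∑ˡ-allVecs-swapAt n m (g ∘ (x ∷_)) i) ⟩
    ∑[ x < n ] ∑ˡ (g ∘ (x ∷_)) (allVecs n m)                 ≡⟨ ∑ˡ-allVecs-suc n m g ⟨
    ∑ˡ g (allVecs n (ℕ.suc m))                               ∎
    where open ≡-Reasoning

  ∑ₚ : ∀ n → (Vec (Fin n) n → ℚ) → ℚ
  ∑ₚ n f = ∑ˡ (λ σ → 𝟙[ isInjective σ ] f σ) (allVecs n n)

  ∑ₚ-swapAt : ∀ n i (f : Vec (Fin n) n → ℚ) → ∑ₚ n (f ∘ swapAt i) ≡ ∑ₚ n f
  ∑ₚ-swapAt n i f = trans (∑ˡ-cong (λ σ → cong (𝟙[_] f (swapAt i σ)) (sym (isInjective-swapAt i σ))) (allVecs n n))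
                          (∑ˡ-allVecs-swapAt n n (λ σ → 𝟙[ isInjective σ ] f σ) i)

  module _ (n : ℕ) where
    𝟙-injective-cong : ∀ {f g : Vec (Fin n) n → ℚ} → (∀ σ → IsPermutation σ → f σ ≡ g σ) →
                       ∀ σ → 𝟙[ isInjective σ ] f σ ≡ 𝟙[ isInjective σ ] g σ
    𝟙-injective-cong f≡g σ with isInjective σ in inj
    ... | true  = f≡g σ (isInjective⇒injective σ inj)
    ... | false = refl

    ∑ₚ-cong : ∀ {f g : Vec (Fin n) n → ℚ} → (∀ σ → IsPermutation σ → f σ ≡ g σ) → ∑ₚ n f ≡ ∑ₚ n g
    ∑ₚ-cong f≡g = ∑ˡ-cong (𝟙-injective-cong f≡g) (allVecs n n)

    ∑ₚ-mono-≤ : ∀ {f g : Vec (Fin n) n → ℚ} → (∀ σ → IsPermutation σ → f σ ≤ g σ) → ∑ₚ n f ≤ ∑ₚ n g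
    ∑ₚ-mono-≤ {f} {g} f≤g = ∑ˡ-mono-≤ 𝟙-mono (allVecs n n)
      where
      𝟙-mono : ∀ σ → 𝟙[ isInjective σ ] f σ ≤ 𝟙[ isInjective σ ] g σ
      𝟙-mono σ with isInjective σ in inj
      ... | true  = f≤g σ (isInjective⇒injective σ inj)
      ... | false = ≤-refl

    *-distribˡ-∑ₚ : ∀ c (f : Vec (Fin n) n → ℚ) → c * ∑ₚ n f ≡ ∑ₚ n (λ σ → c * f σ)
    *-distribˡ-∑ₚ c f = trans (*-distribˡ-∑ˡ c (λ σ → 𝟙[ isInjective σ ] f σ) (allVecs n n)) (∑ˡ-cong *𝟙 (allVecs n n))
      where
      *𝟙 : ∀ σ → c * 𝟙[ isInjective σ ] f σ ≡ 𝟙[ isInjective σ ] (c * f σ)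
      *𝟙 σ with isInjective σ
      ... | true  = refl
      ... | false = *-zeroʳ c

    ∑ₚ-∑-comm : ∀ (f : Vec (Fin n) n → Fin n → ℚ) → ∑ₚ n (λ σ → ∑[ q < n ] f σ q) ≡ ∑[ q < n ] ∑ₚ n (λ σ → f σ q)
    ∑ₚ-∑-comm f = trans (∑ˡ-cong (λ σ → 𝟙-∑ (isInjective σ) (f σ)) (allVecs n n))
                        (∑ˡ-∑-comm n (λ σ q → 𝟙[ isInjective σ ] f σ q) (allVecs n n))
      where
      𝟙-∑ : ∀ b (g : Fin n → ℚ) → 𝟙[ b ] (∑[ q < n ] g q) ≡ ∑[ q < n ] 𝟙[ b ] g q
      𝟙-∑ true  g = refl
      𝟙-∑ false g = sym (∑-zero n λ _ → refl)

    𝟙-∑ₚ : ∀ b (f : Vec (Fin n) n → ℚ) → ∑ₚ n (λ σ → 𝟙[ b ] f σ) ≡ 𝟙[ b ] ∑ₚ n f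
    𝟙-∑ₚ b f = trans (∑ˡ-cong (λ σ → 𝟙-comm (isInjective σ) b (f σ)) (allVecs n n)) (𝟙-∑ˡ b _ (allVecs n n))

  -- The arrival at position q moves to position q + d; those at q + 1, …, q + d move one step earlier.
  delay : ∀ {A : Set} {m} → ℕ → ℕ → Vec A m → Vec A m
  delay q ℕ.zero    σ = σ
  delay q (ℕ.suc d) σ = delay (ℕ.suc q) d (swapAt q σ)

  ∑ₚ-delay : ∀ n q d (f : Vec (Fin n) n → ℚ) → ∑ₚ n (f ∘ delay q d) ≡ ∑ₚ n f
  ∑ₚ-delay n q ℕ.zero    f = refl
  ∑ₚ-delay n q (ℕ.suc d) f = trans (∑ₚ-swapAt n q (f ∘ delay (ℕ.suc q) d)) (∑ₚ-delay n (ℕ.suc q) d f)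

  lookup-delay-beyond : ∀ {A : Set} {m} q d (σ : Vec A m) p → q ℕ.+ d ℕ.< toℕ p → lookup (delay q d σ) p ≡ lookup σ p
  lookup-delay-beyond q ℕ.zero    σ p _ = refl
  lookup-delay-beyond q (ℕ.suc d) σ p q+d<p = begin
    lookup (delay (ℕ.suc q) d (swapAt q σ)) p ≡⟨ lookup-delay-beyond (ℕ.suc q) d (swapAt q σ) p q+d<p′ ⟩
    lookup (swapAt q σ) p                   ≡⟨ lookup-swapAt q σ p ⟩
    lookup σ (swapIndex q p)                ≡⟨ cong (lookup σ) (swapIndex-beyond q p (ℕₚ.≤-trans (ℕ.s≤s (ℕ.s≤s (ℕₚ.m≤m+n q d))) q+d<p′)) ⟩
    lookup σ p                              ∎
    where
    open ≡-Reasoning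
    q+d<p′ : ℕ.suc q ℕ.+ d ℕ.< toℕ p
    q+d<p′ = subst (ℕ._< toℕ p) (ℕₚ.+-suc q d) q+d<p

  lookup-delay-target : ∀ {A : Set} {m} q d (σ : Vec A m) p p′ → toℕ p ≡ q ℕ.+ d → toℕ p′ ≡ q →
                        lookup (delay q d σ) p ≡ lookup σ p′
  lookup-delay-target q ℕ.zero    σ p p′ p≡q p′≡q = cong (lookup σ) (Finₚ.toℕ-injective (trans p≡q (trans (ℕₚ.+-identityʳ q) (sym p′≡q))))
  lookup-delay-target {m = m} q (ℕ.suc d) σ p p′ p≡q+d p′≡q = begin
    lookup (delay (ℕ.suc q) d (swapAt q σ)) p
      ≡⟨ lookup-delay-target (ℕ.suc q) d (swapAt q σ) p q+1 (trans p≡q+d (ℕₚ.+-suc q d)) (Finₚ.toℕ-fromℕ< q+1<m) ⟩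
    lookup (swapAt q σ) q+1
      ≡⟨ lookup-swapAt q σ q+1 ⟩
    lookup σ (swapIndex q q+1)
      ≡⟨ cong (lookup σ) (Finₚ.toℕ-injective (trans (swapIndex-suc q q+1 (Finₚ.toℕ-fromℕ< q+1<m)) (sym p′≡q))) ⟩
    lookup σ p′ ∎
    where
    open ≡-Reasoning
    q+1<m : ℕ.suc q ℕ.< m
    q+1<m = ℕₚ.≤-<-trans (subst (ℕ.suc q ℕ.≤_) (sym (trans p≡q+d (ℕₚ.+-suc q d))) (ℕₚ.m≤m+n (ℕ.suc q) d)) (Finₚ.toℕ<n p)
    q+1 : Fin m
    q+1 = fromℕ< q+1<m

  arrivedUpTo-swapAt : ∀ {n} i (σ : Vec (Fin n) n) c x → ℕ.suc i ℕ.≤ toℕ c → arrivedUpTo (swapAt i σ) c x ≡ arrivedUpTo σ c x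
  arrivedUpTo-swapAt i σ c x i<c = ≡-from-⇔true
    (λ arrived′ → let q , q≤c , σq≡x = arrivedUpTo⇒ (swapAt i σ) c x arrived′ in
      subst (λ y → arrivedUpTo σ c y ≡ true) (trans (sym (lookup-swapAt i σ q)) σq≡x)
            (arrivedUpTo-lookup σ c (swapIndex i q) (swapIndex-≤ i q (toℕ c) i<c q≤c)))
    (λ arrived → let q , q≤c , σq≡x = arrivedUpTo⇒ σ c x arrived in
      subst (λ y → arrivedUpTo (swapAt i σ) c y ≡ true) (trans (sym (lookup-swapAt′ i σ q)) σq≡x)
            (arrivedUpTo-lookup (swapAt i σ) c (swapIndex i q) (swapIndex-≤ i q (toℕ c) i<c q≤c)))

  arrivedUpTo-delay : ∀ {n} q d (σ : Vec (Fin n) n) c x → q ℕ.+ d ℕ.≤ toℕ c → arrivedUpTo (delay q d σ) c x ≡ arrivedUpTo σ c x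
  arrivedUpTo-delay q ℕ.zero    σ c x _       = refl
  arrivedUpTo-delay q (ℕ.suc d) σ c x q+d≤c =
    trans (arrivedUpTo-delay (ℕ.suc q) d (swapAt q σ) c x q+d≤c′)
          (arrivedUpTo-swapAt q σ c x (ℕₚ.≤-trans (ℕ.s≤s (ℕₚ.m≤m+n q d)) q+d≤c′))
    where
    q+d≤c′ : ℕ.suc q ℕ.+ d ℕ.≤ toℕ c
    q+d≤c′ = subst (ℕ._≤ toℕ c) (ℕₚ.+-suc q d) q+d≤c

  ∑ₚ-average : ∀ n m → m ℕ.< n → (f : Vec (Fin n) n → ℚ) →
    ℕtoℚ (ℕ.suc m) * ∑ₚ n f ≡ ∑ₚ n (λ σ → ∑[ q < n ] 𝟙[ toℕ q ℕ.≤ᵇ m ] f (delay (toℕ q) (m ∸ toℕ q) σ))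
  ∑ₚ-average n m m<n f = begin
    ℕtoℚ (ℕ.suc m) * ∑ₚ n f
      ≡⟨ ∑-𝟙-≤ n m (∑ₚ n f) m<n ⟨
    ∑[ q < n ] 𝟙[ toℕ q ℕ.≤ᵇ m ] ∑ₚ n f
      ≡⟨ ∑-cong n (λ q → cong (𝟙[ toℕ q ℕ.≤ᵇ m ]_) (∑ₚ-delay n (toℕ q) (m ∸ toℕ q) f)) ⟨
    ∑[ q < n ] 𝟙[ toℕ q ℕ.≤ᵇ m ] ∑ₚ n (f ∘ delay (toℕ q) (m ∸ toℕ q))
      ≡⟨ ∑-cong n (λ q → 𝟙-∑ₚ n (toℕ q ℕ.≤ᵇ m) _) ⟨
    ∑[ q < n ] ∑ₚ n (λ σ → 𝟙[ toℕ q ℕ.≤ᵇ m ] f (delay (toℕ q) (m ∸ toℕ q) σ))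
      ≡⟨ ∑ₚ-∑-comm n _ ⟨
    ∑ₚ n (λ σ → ∑[ q < n ] 𝟙[ toℕ q ℕ.≤ᵇ m ] f (delay (toℕ q) (m ∸ toℕ q) σ)) ∎
    where open ≡-Reasoning

  ∑ₚ-lookup-≤ : ∀ n (g : Fin n → ℚ) (p p′ : Fin n) → toℕ p ℕ.≤ toℕ p′ → ∑ₚ n (g ∘ (λ σ → lookup σ p)) ≡ ∑ₚ n (g ∘ (λ σ → lookup σ p′))
  ∑ₚ-lookup-≤ n g p p′ p≤p′ = begin
    ∑ₚ n (λ σ → g (lookup σ p))
      ≡⟨ ∑ₚ-cong n (λ σ _ → cong g (lookup-delay-target (toℕ p) (toℕ p′ ∸ toℕ p) σ p′ p (sym (ℕₚ.m+[n∸m]≡n p≤p′)) refl)) ⟨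
    ∑ₚ n (λ σ → g (lookup (delay (toℕ p) (toℕ p′ ∸ toℕ p) σ) p′))
      ≡⟨ ∑ₚ-delay n (toℕ p) (toℕ p′ ∸ toℕ p) (λ σ → g (lookup σ p′)) ⟩
    ∑ₚ n (λ σ → g (lookup σ p′)) ∎
    where open ≡-Reasoning

  ∑ₚ-lookup : ∀ n (g : Fin n → ℚ) (p p′ : Fin n) → ∑ₚ n (λ σ → g (lookup σ p)) ≡ ∑ₚ n (λ σ → g (lookup σ p′))
  ∑ₚ-lookup n g p p′ with ℕₚ.≤-total (toℕ p) (toℕ p′)
  ... | inj₁ p≤p′ = ∑ₚ-lookup-≤ n g p p′ p≤p′
  ... | inj₂ p′≤p = sym (∑ₚ-lookup-≤ n g p′ p p′≤p)

  injective⇒surjective : ∀ {n} (σ : Vec (Fin n) n) → IsPermutation σ → ∀ i → ∃ λ q → lookup σ q ≡ i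
  injective⇒surjective {ℕ.suc n} σ σ-injective i with Finₚ.any? (λ q → lookup σ q Fin.≟ i)
  ... | yes hit = hit
  ... | no miss =
    let q₁ , q₂ , q₁<q₂ , eq = Finₚ.pigeonhole (ℕₚ.n<1+n n) (λ q → Fin.punchOut (i≢σ q))
    in contradiction (σ-injective (Finₚ.punchOut-injective (i≢σ q₁) (i≢σ q₂) eq)) (Finₚ.<⇒≢ q₁<q₂)
    where
    i≢σ : ∀ q → i ≢ lookup σ q
    i≢σ q i≡σq = miss (q , sym i≡σq)

  ∑-reindex : ∀ {n} (σ : Vec (Fin n) n) → IsPermutation σ → (f : Fin n → ℚ) → ∑[ q < n ] f (lookup σ q) ≡ ∑[ i < n ] f i
  ∑-reindex {n} σ σ-injective f = begin
    ∑[ q < n ] f (lookup σ q)                                 ≡⟨ ∑-cong n row ⟨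
    ∑[ q < n ] ∑[ i < n ] 𝟙[ lookup σ q ==ᶠ i ] f i         ≡⟨ ∑-comm (λ q i → 𝟙[ lookup σ q ==ᶠ i ] f i) ⟩
    ∑[ i < n ] ∑[ q < n ] 𝟙[ lookup σ q ==ᶠ i ] f i         ≡⟨ ∑-cong n column ⟩
    ∑[ i < n ] f i                                            ∎
    where
    open ≡-Reasoning
    𝟙-miss : ∀ q i → lookup σ q ≢ i → 𝟙[ lookup σ q ==ᶠ i ] f i ≡ 0ℚ
    𝟙-miss q i σq≢i rewrite ==ᶠ-≢ σq≢i = refl
    row : ∀ q → ∑[ i < n ] 𝟙[ lookup σ q ==ᶠ i ] f i ≡ f (lookup σ q)
    row q = trans (∑-onlyAt n _ (lookup σ q) (λ i i≢σq → 𝟙-miss q i (i≢σq ∘ sym)))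
                  (cong (𝟙[_] f (lookup σ q)) (==ᶠ-refl (lookup σ q)))
    column : ∀ i → ∑[ q < n ] 𝟙[ lookup σ q ==ᶠ i ] f i ≡ f i
    column i = let q₀ , σq₀≡i = injective⇒surjective σ σ-injective i in
      trans (∑-onlyAt n _ q₀ (λ q q≢q₀ → 𝟙-miss q i λ σq≡i → q≢q₀ (σ-injective (trans σq≡i (sym σq₀≡i)))))
            (cong (𝟙[_] f i) (trans (cong (lookup σ q₀ ==ᶠ_) (sym σq₀≡i)) (==ᶠ-refl (lookup σ q₀))))

  ∑ˡ-permutations : ∀ n f → ∑ˡ f (permutations n) ≡ ∑ₚ n f
  ∑ˡ-permutations n f = trans (∑ˡ-filter f (λ σ → isInjective σ Bool.≟ true) (allVecs n n))
                              (∑ˡ-cong (λ σ → cong (𝟙[_] f σ) (does-≟-true (isInjective σ))) (allVecs n n))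
    where
    does-≟-true : ∀ b → does (b Bool.≟ true) ≡ b
    does-≟-true true  = refl
    does-≟-true false = refl

  ∈-allVecs : ∀ n m (v : Vec (Fin n) m) → v ∈ allVecs n m
  ∈-allVecs n ℕ.zero    []      = here refl
  ∈-allVecs n (ℕ.suc m) (x ∷ v) = ∈-concatMap⁺ (λ x → map (x ∷_) (allVecs n m))
    (Any.map (λ { refl → ∈-map⁺ (x ∷_) (∈-allVecs n m v) }) (∈-allFin x))

  identity-∈-permutations : ∀ n → Vec.tabulate {n = n} id ∈ permutations n
  identity-∈-permutations n = ∈-filter⁺ (λ σ → isInjective σ Bool.≟ true) (∈-allVecs n n (Vec.tabulate id))
    (injective⇒isInjective (Vec.tabulate {n = n} id) λ {p} {q} eq →
      trans (sym (Vecₚ.lookup∘tabulate id p)) (trans eq (Vecₚ.lookup∘tabulate id q)))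

  permutations-nonEmpty : ∀ n → ∃ λ x → ∃ λ xs → permutations n ≡ x ∷ xs
  permutations-nonEmpty n with permutations n | identity-∈-permutations n
  ... | x ∷ xs | _ = x , xs , refl

  ∑ˡ-1 : ∀ {A : Set} (xs : List A) → ∑ˡ (λ _ → 1ℚ) xs ≡ ℕtoℚ (length xs)
  ∑ˡ-1 []       = refl
  ∑ˡ-1 (x ∷ xs) = trans (cong (1ℚ +_) (∑ˡ-1 xs)) (sym (ℕtoℚ-suc (length xs)))

  ∑ˡ≡count*mean : ∀ {A : Set} (f : A → ℚ) x xs → ∑ˡ f (x ∷ xs) ≡ ∑ˡ (λ _ → 1ℚ) (x ∷ xs) * mean f (x ∷ xs)
  ∑ˡ≡count*mean f x xs = sym (begin
    ∑ˡ (λ _ → 1ℚ) (x ∷ xs) * (∑ˡ f (x ∷ xs) * (ℤ.+ 1 / ℕ.suc l))  ≡⟨ cong (_* mean f (x ∷ xs)) (∑ˡ-1 (x ∷ xs)) ⟩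
    ℕtoℚ (ℕ.suc l) * (∑ˡ f (x ∷ xs) * (ℤ.+ 1 / ℕ.suc l))          ≡⟨ *-exchangeˡ (ℕtoℚ (ℕ.suc l)) (∑ˡ f (x ∷ xs)) _ ⟩
    ∑ˡ f (x ∷ xs) * (ℕtoℚ (ℕ.suc l) * (ℤ.+ 1 / ℕ.suc l))          ≡⟨ cong (∑ˡ f (x ∷ xs) *_) (ℕtoℚ-suc*1/suc l) ⟩
    ∑ˡ f (x ∷ xs) * 1ℚ                                             ≡⟨ *-identityʳ _ ⟩
    ∑ˡ f (x ∷ xs)                                                  ∎)
    where
    open ≡-Reasoning
    l : ℕ
    l = length xs

  ∑ₚ≡count*mean : ∀ n f → ∑ₚ n f ≡ ∑ₚ n (λ _ → 1ℚ) * mean f (permutations n)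
  ∑ₚ≡count*mean n f with x , xs , perms≡x∷xs ← permutations-nonEmpty n = begin
    ∑ₚ n f                                               ≡⟨ ∑ˡ-permutations n f ⟨
    ∑ˡ f (permutations n)                                ≡⟨ cong (∑ˡ f) perms≡x∷xs ⟩
    ∑ˡ f (x ∷ xs)                                        ≡⟨ ∑ˡ≡count*mean f x xs ⟩
    ∑ˡ (λ _ → 1ℚ) (x ∷ xs) * mean f (x ∷ xs)             ≡⟨ cong (λ ys → ∑ˡ (λ _ → 1ℚ) ys * mean f ys) perms≡x∷xs ⟨
    ∑ˡ (λ _ → 1ℚ) (permutations n) * mean f (permutations n) ≡⟨ cong (_* mean f (permutations n)) (∑ˡ-permutations n (λ _ → 1ℚ)) ⟩
    ∑ₚ n (λ _ → 1ℚ) * mean f (permutations n)           ∎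
    where open ≡-Reasoning

  ∑ₚ-1-positive : ∀ n → Positive (∑ₚ n (λ _ → 1ℚ))
  ∑ₚ-1-positive n with x , xs , perms≡x∷xs ← permutations-nonEmpty n =
    subst Positive (trans (sym (∑ˡ-1 (x ∷ xs))) (trans (cong (∑ˡ (λ _ → 1ℚ)) (sym perms≡x∷xs)) (∑ˡ-permutations n (λ _ → 1ℚ))))
          (ℕtoℚ-suc-positive (length xs))

module Algorithm where
  open BooleanFacts
  open Greedy
  open ArrivalOrders using (IsPermutation)

  tabulate-split : ∀ {A : Set} n (f : Fin n → A) t →
    ∃₂ λ xs ys → tabulate f ≡ xs ++ f t ∷ ys × All (λ x → ∃ λ q → x ≡ f q × toℕ q ℕ.< toℕ t) xs
  tabulate-split (ℕ.suc n) f zero    = [] , tabulate (f ∘ suc) , refl , []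
  tabulate-split (ℕ.suc n) f (suc t) =
    let xs , ys , eq , before = tabulate-split n (f ∘ suc) t
    in f zero ∷ xs , ys , cong (f zero ∷_) eq ,
       (zero , refl , ℕ.s≤s ℕ.z≤n) ∷ All.map (λ { (q , refl , q<t) → suc q , refl , ℕ.s≤s q<t }) before

  allFin-split : ∀ {n} (t : Fin n) → ∃₂ λ xs ys → allFin n ≡ xs ++ t ∷ ys × All (λ u → toℕ u ℕ.< toℕ t) xs
  allFin-split {n} t =
    let xs , ys , eq , before = tabulate-split n id t
    in xs , ys , eq , All.map (λ { (q , refl , q<t) → q<t }) before

  proposal : ∀ {n r} → Adj n r → Rank n r → Vec (Fin n) n → Fin n → Maybe (Fin r)
  proposal adj rank σ p = greedy adj rank (arrivedUpTo σ p) (lookup σ p)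

  module _ {n r : ℕ} (adj : Adj n r) (rank : Rank n r) (k : ℕ) (σ : Vec (Fin n) n) where

    step : Matching n r → Fin n → Matching n r
    step = algStep adj rank k σ

    algStep-cases : ∀ M p → step M p ≡ M ⊎
      ∃ λ j → k ℕ.≤ toℕ p × proposal adj rank σ p ≡ just j × M (lookup σ p) ≡ nothing × step M p ≡ update M (lookup σ p) j
    algStep-cases M p with k ℕ.≤ᵇ toℕ p in k≤p
    ... | false = inj₁ refl
    ... | true with proposal adj rank σ p in prop
    ...   | nothing = inj₁ refl
    ...   | just j with M (lookup σ p) in free | rightFree M j
    ...     | just _  | _     = inj₁ refl
    ...     | nothing | false = inj₁ refl
    ...     | nothing | true  = inj₂ (j , ≤ᵇ-sound k≤p , refl , refl , refl)

    algStep-accepts : ∀ M p j → k ℕ.≤ toℕ p → proposal adj rank σ p ≡ just j → M (lookup σ p) ≡ nothing → rightFree M j ≡ true →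
                      step M p ≡ update M (lookup σ p) j
    algStep-accepts M p j k≤p prop free j-free with k ℕ.≤ᵇ toℕ p in k≤ᵇp
    ... | false = contradiction (trans (sym (≤ᵇ-complete k≤p)) k≤ᵇp) λ ()
    ... | true with proposal adj rank σ p | prop
    ...   | just .j | refl with M (lookup σ p) | free | rightFree M j | j-free
    ...     | nothing | refl | true | refl = refl

    algStep-⊇ : ∀ M p → M ⊆ₘ step M p
    algStep-⊇ M p i j Mi≡j with algStep-cases M p
    ... | inj₁ unchanged = subst (λ M′ → M′ i ≡ just j) (sym unchanged) Mi≡j
    ... | inj₂ (j′ , _ , _ , free , added) = subst (λ M′ → M′ i ≡ just j) (sym added) (update-⊇ M (lookup σ p) j′ free i j Mi≡j)

    algSteps-⊇ : ∀ ps M → M ⊆ₘ foldl step M ps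
    algSteps-⊇ []       M = λ _ _ → id
    algSteps-⊇ (p ∷ ps) M = ⊆ₘ-trans (algStep-⊇ M p) (algSteps-⊇ ps (step M p))

    FromProposals : (Fin n → Set) → Matching n r → Set
    FromProposals P M = ∀ i j → M i ≡ just j → ∃ λ u → P u × k ℕ.≤ toℕ u × lookup σ u ≡ i × proposal adj rank σ u ≡ just j

    algSteps-fromProposals : ∀ P ps M → All P ps → FromProposals P M → FromProposals P (foldl step M ps)
    algSteps-fromProposals P []       M []         fromProp = fromProp
    algSteps-fromProposals P (p ∷ ps) M (Pp ∷ Pps) fromProp = algSteps-fromProposals P ps (step M p) Pps fromProp′
      where
      fromProp′ : FromProposals P (step M p)
      fromProp′ i j eq with algStep-cases M p
      ... | inj₁ unchanged = fromProp i j (subst (λ M′ → M′ i ≡ just j) unchanged eq)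
      ... | inj₂ (j′ , k≤p , prop , _ , added) with update⁻ M (lookup σ p) j′ i j (subst (λ M′ → M′ i ≡ just j) added eq)
      ...   | inj₁ (refl , refl) = p , Pp , k≤p , refl , prop
      ...   | inj₂ Mi≡j          = fromProp i j Mi≡j

    runAlg-edge : ∀ i j → runAlg adj rank k σ i ≡ just j → adj i j ≡ true
    runAlg-edge i j eq =
      let u , _ , _ , σu≡i , prop = algSteps-fromProposals (λ _ → ⊤) (allFin n) emptyM (All.universal _ (allFin n)) (λ _ _ ()) i j eq
      in subst (λ i → adj i j ≡ true) σu≡i (proj₁ (greedy-edge adj rank (arrivedUpTo σ u) (lookup σ u) j prop))

    runAlg-accepts : IsPermutation σ → ∀ t j → k ℕ.≤ toℕ t → proposal adj rank σ t ≡ just j →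
      (∀ u → k ℕ.≤ toℕ u → toℕ u ℕ.< toℕ t → proposal adj rank σ u ≢ just j) → runAlg adj rank k σ (lookup σ t) ≡ just j
    runAlg-accepts σ-injective t j k≤t prop unproposed with xs , ys , allFin≡ , before ← allFin-split t =
      subst (λ ps → foldl step emptyM ps (lookup σ t) ≡ just j) (sym allFin≡)
        (subst (λ M → M (lookup σ t) ≡ just j) (sym (Listₚ.foldl-++ step emptyM xs (t ∷ ys)))
          (algSteps-⊇ ys (step M₀ t) (lookup σ t) j accepted))
      where
      M₀ : Matching n r
      M₀ = foldl step emptyM xs
      fromProp : FromProposals (λ u → toℕ u ℕ.< toℕ t) M₀
      fromProp = algSteps-fromProposals _ xs emptyM before λ _ _ ()
      σt-free : M₀ (lookup σ t) ≡ nothing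
      σt-free with M₀ (lookup σ t) in eq
      ... | nothing = refl
      ... | just j′ = let u , u<t , _ , σu≡σt , _ = fromProp (lookup σ t) j′ eq
                      in contradiction (cong toℕ (σ-injective σu≡σt)) (ℕₚ.<⇒≢ u<t)
      j-free : rightFree M₀ j ≡ true
      j-free with rightFree M₀ j in eq
      ... | true  = refl
      ... | false = let i , M₀i≡j = ¬rightFree⇒matched M₀ j eq
                        u , u<t , k≤u , _ , prop-u = fromProp i j M₀i≡j
                    in contradiction prop-u (unproposed u k≤u u<t)
      accepted : step M₀ t (lookup σ t) ≡ just j
      accepted = subst (λ M → M (lookup σ t) ≡ just j) (sym (algStep-accepts M₀ t j k≤t prop σt-free j-free))
                       (update-≡ M₀ (lookup σ t) j)

module Analysis {n r : ℕ} (adj : Adj n r) (w : Weights n r) (rank : Rank n r)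
  (nonNeg : NonNegWeights adj w) (t : Fin n) where
  open import Data.Rational using (ℚ; 0ℚ; 1ℚ; _+_; _*_; _≤_)
  open import Data.Rational.Properties
  open Arithmetic
  open Sums
  open BooleanFacts
  open Greedy
  open WeightFacts
  open ArrivalOrders
  open Algorithm

  G : Vec (Fin n) n → Fin n → Matching n r
  G σ c = greedy adj rank (arrivedUpTo σ c)

  target : Vec (Fin n) n → Maybe (Fin r)
  target σ = proposal adj rank σ t

  proposedWeight : Vec (Fin n) n → ℚ
  proposedWeight σ = weightAt w (G σ t) (lookup σ t)

  clashes : Maybe (Fin r) → Maybe (Fin r) → Bool
  clashes nothing  _ = false
  clashes (just j) m = isMatchedTo m j

  clashesAt : Vec (Fin n) n → Fin n → Bool
  clashesAt σ u = clashes (target σ) (proposal adj rank σ u)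

  challengedFrom : ℕ → Vec (Fin n) n → Fin n → Bool
  challengedFrom m σ u = (m ℕ.≤ᵇ toℕ u) ∧ (ℕ.suc (toℕ u) ℕ.≤ᵇ toℕ t) ∧ clashesAt σ u

  unchallengedFrom : ℕ → Vec (Fin n) n → Bool
  unchallengedFrom m σ = not (any (challengedFrom m σ) (allFin n))

  keptWeight : ℕ → Vec (Fin n) n → ℚ
  keptWeight m σ = 𝟙[ unchallengedFrom m σ ] proposedWeight σ

  unchallengedFrom⇒ : ∀ m σ → unchallengedFrom m σ ≡ true → ∀ u → m ℕ.≤ toℕ u → toℕ u ℕ.< toℕ t → clashesAt σ u ≡ false
  unchallengedFrom⇒ m σ unchallenged u m≤u u<t with clashesAt σ u in clash
  ... | false = refl
  ... | true  = contradiction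
        (any-intro (challengedFrom m σ) (allFin n) (∈-allFin u)
          (subst₂ (λ a b → a ∧ b ∧ clashesAt σ u ≡ true) (sym (≤ᵇ-complete m≤u)) (sym (≤ᵇ-complete u<t)) clash))
        (λ challenged → contradiction (trans (sym (cong not challenged)) unchallenged) λ ())

  unchallengedFrom⇐ : ∀ m σ → (∀ u → m ℕ.≤ toℕ u → toℕ u ℕ.< toℕ t → clashesAt σ u ≡ false) → unchallengedFrom m σ ≡ true
  unchallengedFrom⇐ m σ noClash with any (challengedFrom m σ) (allFin n) in challenged
  ... | false = refl
  ... | true  = let u , _ , challengedᵤ = any-true (challengedFrom m σ) (allFin n) challenged
                    m≤u , u<t∧clash = ∧-true challengedᵤ
                    u<t , clash = ∧-true u<t∧clash
                in contradiction (trans (sym clash) (noClash u (≤ᵇ-sound m≤u) (≤ᵇ-sound u<t))) λ ()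

  keptWeight-t : ∀ σ → keptWeight (toℕ t) σ ≡ proposedWeight σ
  keptWeight-t σ = cong (𝟙[_] proposedWeight σ) (unchallengedFrom⇐ (toℕ t) σ λ u t≤u u<t → contradiction u<t (ℕₚ.≤⇒≯ t≤u))

  unchallengedFrom-suc : ∀ m σ u₀ → toℕ u₀ ≡ m → m ℕ.< toℕ t →
    unchallengedFrom m σ ≡ not (clashesAt σ u₀) ∧ unchallengedFrom (ℕ.suc m) σ
  unchallengedFrom-suc m σ u₀ u₀≡m m<t = ≡-from-⇔true
    (λ unchallenged → subst₂ (λ a b → not a ∧ b ≡ true)
      (sym (unchallengedFrom⇒ m σ unchallenged u₀ (ℕₚ.≤-reflexive (sym u₀≡m)) (subst (ℕ._< toℕ t) (sym u₀≡m) m<t)))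
      (sym (unchallengedFrom⇐ (ℕ.suc m) σ λ u m<u → unchallengedFrom⇒ m σ unchallenged u (ℕₚ.<⇒≤ m<u))) refl)
    (λ unchallenged → let unclashed₀ , unchallenged′ = ∧-true unchallenged in unchallengedFrom⇐ m σ λ u m≤u u<t →
      case ℕₚ.m≤n⇒m<n∨m≡n m≤u of λ
        { (inj₁ m<u) → unchallengedFrom⇒ (ℕ.suc m) σ unchallenged′ u m<u u<t
        ; (inj₂ m≡u) → subst (λ u → clashesAt σ u ≡ false) (Finₚ.toℕ-injective (trans u₀≡m m≡u))
                              (trans (sym (Boolₚ.not-involutive _)) (cong not unclashed₀)) })

  keptWeight-suc : ∀ m σ u₀ → toℕ u₀ ≡ m → m ℕ.< toℕ t → keptWeight m σ ≡ 𝟙[ not (clashesAt σ u₀) ] keptWeight (ℕ.suc m) σ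
  keptWeight-suc m σ u₀ u₀≡m m<t =
    trans (cong (𝟙[_] proposedWeight σ) (unchallengedFrom-suc m σ u₀ u₀≡m m<t))
          (𝟙-∧ (not (clashesAt σ u₀)) (unchallengedFrom (ℕ.suc m) σ) (proposedWeight σ))

  module Delayed (σ : Vec (Fin n) n) (q : Fin n) (m : ℕ) (q≤m : toℕ q ℕ.≤ m) where
    σ′ : Vec (Fin n) n
    σ′ = delay (toℕ q) (m ∸ toℕ q) σ

    q+d≡m : toℕ q ℕ.+ (m ∸ toℕ q) ≡ m
    q+d≡m = ℕₚ.m+[n∸m]≡n q≤m

    G-delay : ∀ c → m ℕ.≤ toℕ c → G σ′ c ≗ G σ c
    G-delay c m≤c = greedy-cong adj rank λ x → arrivedUpTo-delay (toℕ q) (m ∸ toℕ q) σ c x (subst (ℕ._≤ toℕ c) (sym q+d≡m) m≤c)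

    proposal-delay : ∀ u → m ℕ.< toℕ u → proposal adj rank σ′ u ≡ proposal adj rank σ u
    proposal-delay u m<u = trans (cong (G σ′ u) (lookup-delay-beyond (toℕ q) (m ∸ toℕ q) σ u (subst (ℕ._< toℕ u) (sym q+d≡m) m<u)))
                                 (G-delay u (ℕₚ.<⇒≤ m<u) (lookup σ u))

    module _ (m<t : m ℕ.< toℕ t) where
      target-delay : target σ′ ≡ target σ
      target-delay = proposal-delay t m<t

      proposedWeight-delay : proposedWeight σ′ ≡ proposedWeight σ
      proposedWeight-delay =
        trans (cong (weightAt w (G σ′ t)) (lookup-delay-beyond (toℕ q) (m ∸ toℕ q) σ t (subst (ℕ._< toℕ t) (sym q+d≡m) m<t)))
              (weightAt-cong w (G σ′ t) {G σ t} (lookup σ t) (G-delay t (ℕₚ.<⇒≤ m<t) (lookup σ t)))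

      clashesAt-delay : ∀ u → m ℕ.< toℕ u → clashesAt σ′ u ≡ clashesAt σ u
      clashesAt-delay u m<u = cong₂ clashes target-delay (proposal-delay u m<u)

      keptWeight-suc-delay : keptWeight (ℕ.suc m) σ′ ≡ keptWeight (ℕ.suc m) σ
      keptWeight-suc-delay = cong₂ 𝟙[_]_ (≡-from-⇔true
        (λ unchallenged → unchallengedFrom⇐ (ℕ.suc m) σ λ u m<u u<t →
           trans (sym (clashesAt-delay u m<u)) (unchallengedFrom⇒ (ℕ.suc m) σ′ unchallenged u m<u u<t))
        (λ unchallenged → unchallengedFrom⇐ (ℕ.suc m) σ′ λ u m<u u<t →
           trans (clashesAt-delay u m<u) (unchallengedFrom⇒ (ℕ.suc m) σ unchallenged u m<u u<t)))
        proposedWeight-delay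

      keptWeight-delay : ∀ u₀ → toℕ u₀ ≡ m →
        keptWeight m σ′ ≡ 𝟙[ not (clashes (target σ) (G σ u₀ (lookup σ q))) ] keptWeight (ℕ.suc m) σ
      keptWeight-delay u₀ u₀≡m = trans (keptWeight-suc m σ′ u₀ u₀≡m m<t) (cong₂ (λ b → 𝟙[ not b ]_) clashesAt₀ keptWeight-suc-delay)
        where
        clashesAt₀ : clashesAt σ′ u₀ ≡ clashes (target σ) (G σ u₀ (lookup σ q))
        clashesAt₀ = cong₂ clashes target-delay
          (trans (cong (G σ′ u₀) (lookup-delay-target (toℕ q) (m ∸ toℕ q) σ u₀ q (trans u₀≡m (sym q+d≡m)) refl))
                 (G-delay u₀ (ℕₚ.≤-reflexive (sym u₀≡m)) (lookup σ q)))

  proposedWeight-nonNeg : ∀ σ → 0ℚ ≤ proposedWeight σ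
  proposedWeight-nonNeg σ = weightAt-nonNeg w (G σ t) nonNeg (λ i j → proj₁ ∘ greedy-edge adj rank (arrivedUpTo σ t) i j) (lookup σ t)

  clashes-unique : ∀ (M : Matching n r) → RightInjective adj rank M → ∀ mt i i′ →
                   clashes mt (M i) ≡ true → clashes mt (M i′) ≡ true → i ≡ i′
  clashes-unique M rightInj (just j) i i′ clash clash′ =
    rightInj i i′ j (isMatchedTo⇒≡ (M i) j clash) (isMatchedTo⇒≡ (M i′) j clash′)

  -- Moving one of the first m + 1 arrivals to position m leaves keptWeight (m + 1) unchanged,
  -- and greedy matches at most one of them to the target of the proposal at t.
  delayedKept-bound : ∀ σ → IsPermutation σ → ∀ m → m ℕ.< toℕ t →
    ℕtoℚ m * keptWeight (ℕ.suc m) σ ≤ ∑[ q < n ] 𝟙[ toℕ q ℕ.≤ᵇ m ] keptWeight m (delay (toℕ q) (m ∸ toℕ q) σ)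
  delayedKept-bound σ σ-injective m m<t = +-cancelˡ-≤ c (begin
    c + ℕtoℚ m * c                          ≡⟨ ℕtoℚ-suc-* m c ⟨
    ℕtoℚ (ℕ.suc m) * c                      ≡⟨ ∑-𝟙-≤ n m c m<n ⟨
    ∑[ q < n ] 𝟙[ toℕ q ℕ.≤ᵇ m ] c          ≡⟨ ∑-cong n (λ q → 𝟙-split (toℕ q ℕ.≤ᵇ m) (B q) c) ⟨
    ∑[ q < n ] (𝟙[ toℕ q ℕ.≤ᵇ m ] 𝟙[ not (B q) ] c + 𝟙[ toℕ q ℕ.≤ᵇ m ] 𝟙[ B q ] c)
                                             ≡⟨ ∑-distrib-+ (λ q → 𝟙[ toℕ q ℕ.≤ᵇ m ] 𝟙[ not (B q) ] c) _ ⟩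
    kept + ∑[ q < n ] 𝟙[ toℕ q ℕ.≤ᵇ m ] 𝟙[ B q ] c
                                             ≤⟨ +-monoʳ-≤ kept (≤-trans (∑-mono-≤ n λ q → 𝟙≤ (toℕ q ℕ.≤ᵇ m) (𝟙-nonNeg (B q) 0≤c))
                                                  (∑-𝟙-atMostOne n B B-unique 0≤c)) ⟩
    kept + c                                 ≡⟨ +-comm kept c ⟩
    c + kept                                 ≡⟨ cong (c +_) (∑-cong n delayed) ⟨
    c + ∑[ q < n ] 𝟙[ toℕ q ℕ.≤ᵇ m ] keptWeight m (delay (toℕ q) (m ∸ toℕ q) σ) ∎)
    where
    open ≤-Reasoning
    c : ℚ
    c = keptWeight (ℕ.suc m) σ
    0≤c : 0ℚ ≤ c
    0≤c = 𝟙-nonNeg (unchallengedFrom (ℕ.suc m) σ) (proposedWeight-nonNeg σ)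
    m<n : m ℕ.< n
    m<n = ℕₚ.<-trans m<t (Finₚ.toℕ<n t)
    u₀ : Fin n
    u₀ = fromℕ< m<n
    B : Fin n → Bool
    B q = clashes (target σ) (G σ u₀ (lookup σ q))
    B-unique : ∀ q q′ → B q ≡ true → B q′ ≡ true → q ≡ q′
    B-unique q q′ Bq Bq′ = σ-injective
      (clashes-unique (G σ u₀) (greedy-rightInjective adj rank (arrivedUpTo σ u₀)) (target σ) (lookup σ q) (lookup σ q′) Bq Bq′)
    kept : ℚ
    kept = ∑[ q < n ] 𝟙[ toℕ q ℕ.≤ᵇ m ] 𝟙[ not (B q) ] c
    delayed : ∀ q → 𝟙[ toℕ q ℕ.≤ᵇ m ] keptWeight m (delay (toℕ q) (m ∸ toℕ q) σ) ≡ 𝟙[ toℕ q ℕ.≤ᵇ m ] 𝟙[ not (B q) ] c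
    delayed q with toℕ q ℕ.≤ᵇ m in q≤m
    ... | false = refl
    ... | true  = Delayed.keptWeight-delay σ q m (≤ᵇ-sound q≤m) m<t u₀ (Finₚ.toℕ-fromℕ< m<n)

  keptWeight-step : ∀ m → m ℕ.< toℕ t → ℕtoℚ m * ∑ₚ n (keptWeight (ℕ.suc m)) ≤ ℕtoℚ (ℕ.suc m) * ∑ₚ n (keptWeight m)
  keptWeight-step m m<t = begin
    ℕtoℚ m * ∑ₚ n (keptWeight (ℕ.suc m))                  ≡⟨ *-distribˡ-∑ₚ n (ℕtoℚ m) (keptWeight (ℕ.suc m)) ⟩
    ∑ₚ n (λ σ → ℕtoℚ m * keptWeight (ℕ.suc m) σ)          ≤⟨ ∑ₚ-mono-≤ n (λ σ σ-injective → delayedKept-bound σ σ-injective m m<t) ⟩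
    ∑ₚ n (λ σ → ∑[ q < n ] 𝟙[ toℕ q ℕ.≤ᵇ m ] keptWeight m (delay (toℕ q) (m ∸ toℕ q) σ))
                                                           ≡⟨ ∑ₚ-average n m (ℕₚ.<-trans m<t (Finₚ.toℕ<n t)) (keptWeight m) ⟨
    ℕtoℚ (ℕ.suc m) * ∑ₚ n (keptWeight m)                  ∎
    where open ≤-Reasoning

  keptWeight-chain : ∀ m → m ℕ.≤ toℕ t → ℕtoℚ m * ∑ₚ n proposedWeight ≤ ℕtoℚ (toℕ t) * ∑ₚ n (keptWeight m)
  keptWeight-chain m m≤t = go (toℕ t ∸ m) m (ℕₚ.m+[n∸m]≡n m≤t)
    where
    tℚ : ℚ
    tℚ = ℕtoℚ (toℕ t)
    go : ∀ d m → m ℕ.+ d ≡ toℕ t → ℕtoℚ m * ∑ₚ n proposedWeight ≤ tℚ * ∑ₚ n (keptWeight m)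
    go ℕ.zero    m m+0≡t rewrite ℕₚ.+-identityʳ m | m+0≡t =
      ≤-reflexive (cong (tℚ *_) (∑ₚ-cong n λ σ _ → sym (keptWeight-t σ)))
    go (ℕ.suc d) m m+d≡t = *-cancelˡ-≤-suc m (begin
      ℕtoℚ (ℕ.suc m) * (ℕtoℚ m * ∑ₚ n proposedWeight)   ≡⟨ *-exchangeˡ (ℕtoℚ (ℕ.suc m)) (ℕtoℚ m) _ ⟩
      ℕtoℚ m * (ℕtoℚ (ℕ.suc m) * ∑ₚ n proposedWeight)   ≤⟨ ℕtoℚ-*-monoˡ-≤ m (go d (ℕ.suc m) (trans (sym (ℕₚ.+-suc m d)) m+d≡t)) ⟩
      ℕtoℚ m * (tℚ * ∑ₚ n (keptWeight (ℕ.suc m)))        ≡⟨ *-exchangeˡ (ℕtoℚ m) tℚ _ ⟩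
      tℚ * (ℕtoℚ m * ∑ₚ n (keptWeight (ℕ.suc m)))        ≤⟨ ℕtoℚ-*-monoˡ-≤ (toℕ t) (keptWeight-step m m<t) ⟩
      tℚ * (ℕtoℚ (ℕ.suc m) * ∑ₚ n (keptWeight m))        ≡⟨ *-exchangeˡ tℚ (ℕtoℚ (ℕ.suc m)) _ ⟩
      ℕtoℚ (ℕ.suc m) * (tℚ * ∑ₚ n (keptWeight m))        ∎)
      where
      open ≤-Reasoning
      m<t : m ℕ.< toℕ t
      m<t = subst (m ℕ.<_) m+d≡t (ℕₚ.≤-trans (ℕ.s≤s (ℕₚ.m≤m+n m d)) (ℕₚ.≤-reflexive (sym (ℕₚ.+-suc m d))))

  A-nonNeg : ∀ k σ → 0ℚ ≤ A adj w rank k t σ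
  A-nonNeg k σ = weightAt-nonNeg w (runAlg adj rank k σ) nonNeg (runAlg-edge adj rank k σ) (lookup σ t)

  keptWeight≤A : ∀ k → k ℕ.≤ toℕ t → ∀ σ → IsPermutation σ → keptWeight k σ ≤ A adj w rank k t σ
  keptWeight≤A k k≤t σ σ-injective with unchallengedFrom k σ in unchallenged
  ... | false = A-nonNeg k σ
  ... | true  = proposed≤A (target σ) refl
    where
    proposed≤A : ∀ mt → target σ ≡ mt → proposedWeight σ ≤ A adj w rank k t σ
    proposed≤A nothing  targetσ = ≤-trans (≤-reflexive (weightAt-nothing w (G σ t) (lookup σ t) targetσ)) (A-nonNeg k σ)
    proposed≤A (just j) targetσ = ≤-reflexive (trans (weightAt-just w (G σ t) (lookup σ t) j targetσ)
      (sym (weightAt-just w (runAlg adj rank k σ) (lookup σ t) j (runAlg-accepts adj rank k σ σ-injective t j k≤t targetσ unproposed))))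
      where
      unproposed : ∀ u → k ℕ.≤ toℕ u → toℕ u ℕ.< toℕ t → proposal adj rank σ u ≢ just j
      unproposed u k≤u u<t propᵤ = contradiction
        (trans (sym (isMatchedTo-just j)) (trans (sym (cong₂ clashes targetσ propᵤ)) (unchallengedFrom⇒ k σ unchallenged u k≤u u<t)))
        λ ()

  arrivedUpTo-lookup-injective : ∀ σ → IsPermutation σ → ∀ q → arrivedUpTo σ t (lookup σ q) ≡ (toℕ q ℕ.≤ᵇ toℕ t)
  arrivedUpTo-lookup-injective σ σ-injective q = ≡-from-⇔true
    (λ arrived → let q′ , q′≤t , σq′≡σq = arrivedUpTo⇒ σ t (lookup σ q) arrived
                 in ≤ᵇ-complete (subst (λ u → toℕ u ℕ.≤ toℕ t) (σ-injective σq′≡σq) q′≤t))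
    (λ q≤t → arrivedUpTo-lookup σ t q (≤ᵇ-sound q≤t))

  proposedWeight-delay-to-t : ∀ σ → IsPermutation σ → ∀ q →
    𝟙[ toℕ q ℕ.≤ᵇ toℕ t ] proposedWeight (delay (toℕ q) (toℕ t ∸ toℕ q) σ) ≡ weightAt w (G σ t) (lookup σ q)
  proposedWeight-delay-to-t σ σ-injective q with toℕ q ℕ.≤ᵇ toℕ t in q≤t
  ... | true  = trans (cong (weightAt w (G σ′ t)) (lookup-delay-target (toℕ q) (toℕ t ∸ toℕ q) σ t q (sym q+d≡m) refl))
                      (weightAt-cong w (G σ′ t) {G σ t} (lookup σ q) (G-delay t ℕₚ.≤-refl (lookup σ q)))
    where open Delayed σ q (toℕ t) (≤ᵇ-sound q≤t)
  ... | false = sym (weightAt-nothing w (G σ t) (lookup σ q) unmatched)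
    where
    unmatched : G σ t (lookup σ q) ≡ nothing
    unmatched with G σ t (lookup σ q) in eq
    ... | nothing = refl
    ... | just j  = contradiction (trans (sym q≤t) (trans (sym (arrivedUpTo-lookup-injective σ σ-injective q))
                                  (proj₂ (greedy-edge adj rank (arrivedUpTo σ t) (lookup σ q) j eq)))) λ ()

  module _ (order : IsEdgeOrder adj w rank) (Ms : Matching n r) (Ms-matching : IsMatching adj Ms) where
    open HalfApproximation adj w rank nonNeg order using (greedy-halfApproximation)

    optimalAt : Vec (Fin n) n → Fin n → ℚ
    optimalAt σ q = weightAt w Ms (lookup σ q)

    arrivedOptimal≤2proposed : ∀ σ → IsPermutation σ →
      ∑[ q < n ] 𝟙[ toℕ q ℕ.≤ᵇ toℕ t ] optimalAt σ q ≤
      ℕtoℚ 2 * ∑[ q < n ] 𝟙[ toℕ q ℕ.≤ᵇ toℕ t ] proposedWeight (delay (toℕ q) (toℕ t ∸ toℕ q) σ)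
    arrivedOptimal≤2proposed σ σ-injective = begin
      ∑[ q < n ] 𝟙[ toℕ q ℕ.≤ᵇ toℕ t ] optimalAt σ q
        ≡⟨ ∑-cong n (λ q → cong (𝟙[_] optimalAt σ q) (arrivedUpTo-lookup-injective σ σ-injective q)) ⟨
      ∑[ q < n ] 𝟙[ arrivedUpTo σ t (lookup σ q) ] weightAt w Ms (lookup σ q)
        ≡⟨ ∑-reindex σ σ-injective (λ i → 𝟙[ arrivedUpTo σ t i ] weightAt w Ms i) ⟩
      ∑[ i < n ] 𝟙[ arrivedUpTo σ t i ] weightAt w Ms i
        ≤⟨ greedy-halfApproximation Ms Ms-matching (arrivedUpTo σ t) ⟩
      weight w (G σ t) + weight w (G σ t)
        ≡⟨ x+x≡2*x (weight w (G σ t)) ⟩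
      ℕtoℚ 2 * weight w (G σ t)
        ≡⟨ cong (ℕtoℚ 2 *_) (trans (∑ˡ-allFin n (weightAt w (G σ t))) (sym (∑-reindex σ σ-injective (weightAt w (G σ t))))) ⟩
      ℕtoℚ 2 * ∑[ q < n ] weightAt w (G σ t) (lookup σ q)
        ≡⟨ cong (ℕtoℚ 2 *_) (∑-cong n (proposedWeight-delay-to-t σ σ-injective)) ⟨
      ℕtoℚ 2 * ∑[ q < n ] 𝟙[ toℕ q ℕ.≤ᵇ toℕ t ] proposedWeight (delay (toℕ q) (toℕ t ∸ toℕ q) σ) ∎
      where open ≤-Reasoning

    optimalAt-t≤2proposed : ∑ₚ n (λ σ → optimalAt σ t) ≤ ℕtoℚ 2 * ∑ₚ n proposedWeight
    optimalAt-t≤2proposed = *-cancelˡ-≤-suc (toℕ t) (begin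
      t+1ℚ * Z
        ≡⟨ ∑-𝟙-≤ n (toℕ t) Z t<n ⟨
      ∑[ q < n ] 𝟙[ toℕ q ℕ.≤ᵇ toℕ t ] Z
        ≡⟨ ∑-cong n (λ q → cong (𝟙[ toℕ q ℕ.≤ᵇ toℕ t ]_) (∑ₚ-lookup n (weightAt w Ms) q t)) ⟨
      ∑[ q < n ] 𝟙[ toℕ q ℕ.≤ᵇ toℕ t ] ∑ₚ n (λ σ → optimalAt σ q)
        ≡⟨ ∑-cong n (λ q → 𝟙-∑ₚ n (toℕ q ℕ.≤ᵇ toℕ t) (λ σ → optimalAt σ q)) ⟨
      ∑[ q < n ] ∑ₚ n (λ σ → 𝟙[ toℕ q ℕ.≤ᵇ toℕ t ] optimalAt σ q)
        ≡⟨ ∑ₚ-∑-comm n (λ σ q → 𝟙[ toℕ q ℕ.≤ᵇ toℕ t ] optimalAt σ q) ⟨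
      ∑ₚ n (λ σ → ∑[ q < n ] 𝟙[ toℕ q ℕ.≤ᵇ toℕ t ] optimalAt σ q)
        ≤⟨ ∑ₚ-mono-≤ n arrivedOptimal≤2proposed ⟩
      ∑ₚ n (λ σ → ℕtoℚ 2 * ∑[ q < n ] 𝟙[ toℕ q ℕ.≤ᵇ toℕ t ] proposedWeight (delay (toℕ q) (toℕ t ∸ toℕ q) σ))
        ≡⟨ *-distribˡ-∑ₚ n (ℕtoℚ 2) _ ⟨
      ℕtoℚ 2 * ∑ₚ n (λ σ → ∑[ q < n ] 𝟙[ toℕ q ℕ.≤ᵇ toℕ t ] proposedWeight (delay (toℕ q) (toℕ t ∸ toℕ q) σ))
        ≡⟨ cong (ℕtoℚ 2 *_) (∑ₚ-average n (toℕ t) t<n proposedWeight) ⟨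
      ℕtoℚ 2 * (t+1ℚ * ∑ₚ n proposedWeight)
        ≡⟨ *-exchangeˡ (ℕtoℚ 2) t+1ℚ _ ⟩
      t+1ℚ * (ℕtoℚ 2 * ∑ₚ n proposedWeight) ∎)
      where
      open ≤-Reasoning
      t<n : toℕ t ℕ.< n
      t<n = Finₚ.toℕ<n t
      t+1ℚ Z : ℚ
      t+1ℚ = ℕtoℚ (ℕ.suc (toℕ t))
      Z = ∑ₚ n (λ σ → optimalAt σ t)

    n*optimalAt-t : ℕtoℚ n * ∑ₚ n (λ σ → optimalAt σ t) ≡ weight w Ms * ∑ₚ n (λ _ → 1ℚ)
    n*optimalAt-t = begin
      ℕtoℚ n * Z
        ≡⟨ ∑-const n Z ⟨
      ∑[ q < n ] Z
        ≡⟨ ∑-cong n (λ q → ∑ₚ-lookup n (weightAt w Ms) q t) ⟨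
      ∑[ q < n ] ∑ₚ n (λ σ → optimalAt σ q)
        ≡⟨ ∑ₚ-∑-comm n optimalAt ⟨
      ∑ₚ n (λ σ → ∑[ q < n ] optimalAt σ q)
        ≡⟨ ∑ₚ-cong n (λ σ σ-injective → trans (∑-reindex σ σ-injective (weightAt w Ms)) (sym (∑ˡ-allFin n (weightAt w Ms)))) ⟩
      ∑ₚ n (λ _ → weight w Ms)
        ≡⟨ ∑ₚ-cong n (λ _ _ → *-identityʳ (weight w Ms)) ⟨
      ∑ₚ n (λ _ → weight w Ms * 1ℚ)
        ≡⟨ *-distribˡ-∑ₚ n (weight w Ms) (λ _ → 1ℚ) ⟨
      weight w Ms * ∑ₚ n (λ _ → 1ℚ) ∎
      where
      open ≡-Reasoning
      Z : ℚ
      Z = ∑ₚ n (λ σ → optimalAt σ t)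

    optimum≤2n*proposed : weight w Ms * ∑ₚ n (λ _ → 1ℚ) ≤ ℕtoℚ (2 ℕ.* n) * ∑ₚ n proposedWeight
    optimum≤2n*proposed = begin
      weight w Ms * ∑ₚ n (λ _ → 1ℚ)                ≡⟨ n*optimalAt-t ⟨
      ℕtoℚ n * ∑ₚ n (λ σ → optimalAt σ t)          ≤⟨ ℕtoℚ-*-monoˡ-≤ n optimalAt-t≤2proposed ⟩
      ℕtoℚ n * (ℕtoℚ 2 * ∑ₚ n proposedWeight)      ≡⟨ *-exchangeˡ (ℕtoℚ n) (ℕtoℚ 2) _ ⟩
      ℕtoℚ 2 * (ℕtoℚ n * ∑ₚ n proposedWeight)      ≡⟨ *-assoc (ℕtoℚ 2) (ℕtoℚ n) _ ⟨
      ℕtoℚ 2 * ℕtoℚ n * ∑ₚ n proposedWeight        ≡⟨ cong (_* ∑ₚ n proposedWeight) (ℕtoℚ-* 2 n) ⟨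
      ℕtoℚ (2 ℕ.* n) * ∑ₚ n proposedWeight         ∎
      where open ≤-Reasoning

open import Data.Nat using (ℕ; _≤_; _*_)
open import Data.Fin using (Fin; toℕ)
open import Data.Rational using (ℚ) renaming (_≤_ to _≤ℚ_; _*_ to _*ℚ_)

-- p is 0-indexed (toℕ p = ℓ - 1); the bound holds for every k ≤ ℓ - 1.
mainTheorem4 : (n r : ℕ) (adj : Adj n r) (w : Weights n r) (rank : Rank n r) →
    NonNegWeights adj w → IsEdgeOrder adj w rank →
    (k : ℕ) → IsFloorNDivE n k →
    (Mstar : Matching n r) → IsMaxWeightMatching adj w Mstar →
    (p : Fin n) → k ≤ toℕ p →
    ℕtoℚ k *ℚ weight w Mstar ≤ℚ ExpectedA adj w rank k p *ℚ ℕtoℚ (toℕ p * (2 * n))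
mainTheorem4 n r adj w rank nonNeg order k _ Mstar (Mstar-matching , _) p k≤p =
  *-cancelˡ-≤-pos P {{∑ₚ-1-positive n}} (begin
    P *ℚ (K *ℚ W)                          ≡⟨ solve 3 (λ P K W → P ⊕ (K ⊕ W) ⊜ K ⊕ (W ⊕ P)) refl P K W ⟩
    K *ℚ (W *ℚ P)                          ≤⟨ ℕtoℚ-*-monoˡ-≤ k (optimum≤2n*proposed order Mstar Mstar-matching) ⟩
    K *ℚ (2n *ℚ ∑ₚ n proposedWeight)       ≡⟨ *-exchangeˡ K 2n _ ⟩
    2n *ℚ (K *ℚ ∑ₚ n proposedWeight)       ≤⟨ ℕtoℚ-*-monoˡ-≤ (2 * n) (keptWeight-chain k k≤p) ⟩
    2n *ℚ (ℓ-1 *ℚ ∑ₚ n (keptWeight k))     ≤⟨ ℕtoℚ-*-monoˡ-≤ (2 * n) (ℕtoℚ-*-monoˡ-≤ (toℕ p) (∑ₚ-mono-≤ n (keptWeight≤A k k≤p))) ⟩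
    2n *ℚ (ℓ-1 *ℚ ∑ₚ n (A adj w rank k p)) ≡⟨ cong (λ x → 2n *ℚ (ℓ-1 *ℚ x)) (∑ₚ≡count*mean n (A adj w rank k p)) ⟩
    2n *ℚ (ℓ-1 *ℚ (P *ℚ E))                ≡⟨ solve 4 (λ a b P E → a ⊕ (b ⊕ (P ⊕ E)) ⊜ P ⊕ (E ⊕ (b ⊕ a))) refl 2n ℓ-1 P E ⟩
    P *ℚ (E *ℚ (ℓ-1 *ℚ 2n))                ≡⟨ cong (λ x → P *ℚ (E *ℚ x)) (ℕtoℚ-* (toℕ p) (2 * n)) ⟨
    P *ℚ (E *ℚ ℕtoℚ (toℕ p * (2 * n)))     ∎)
  where
  open import Data.Rational using (1ℚ)
  open import Data.Rational.Properties using (*-cancelˡ-≤-pos; *-1-commutativeMonoid; module ≤-Reasoning)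
  open import Algebra.Solver.CommutativeMonoid *-1-commutativeMonoid using (solve; _⊜_; _⊕_)
  open ≤-Reasoning
  open Arithmetic
  open ArrivalOrders
  open Analysis adj w rank nonNeg p
  P K W ℓ-1 2n E : ℚ
  P   = ∑ₚ n (λ _ → 1ℚ)
  K   = ℕtoℚ k
  W   = weight w Mstar
  ℓ-1 = ℕtoℚ (toℕ p)
  2n  = ℕtoℚ (2 * n)
  E   = ExpectedA adj w rank k p
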